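{- Let $H$ be a fixed connected finite simple graph. There exists an algorithm (whose complexity depends on $H$) which, given as input any finite simple graph $G$, produces finitely many finite simple graphs $G_1, G_2, \ldots, G_r$ derived from $G$ such that there exist rational numbers $a_1,\dots,a_r$ with $$\pi_G^{(H)}(k) = \sum_{i=1}^r a_i\, \pi_{G_i}(k) \quad \text{for every positive integer } k.$$
   Context: All graphs are finite and simple. For a graph $G$ and a positive integer $k$, a proper $k$-coloring of $G$ is a map $\phi: V(G)\to\{1,\dots,k\}$ with $\phi(u)\neq\phi(w)$ whenever $uw\in E(G)$. $\pi_G(k)$ denotes the chromatic polynomial, i.e. the number of proper $k$-colorings of $G$. The $k$-coloring graph $\mathcal{C}_k(G)$ has the proper $k$-colorings of $G$ as vertices, two colorings being adjacent iff they differ in the color of exactly one vertex of $G$. For a graph $H$, $\pi_G^{(H)}(k)$ denotes the number of induced subgraphs of $\mathcal{C}_k(G)$ isomorphic to $H$, i.e. the number of vertex subsets $U\subseteq V(\mathcal{C}_k(G))$ such that the induced subgraph $\mathcal{C}_k(G)[U]$ is isomorphic to $H$. -}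

module Defs where

open import Data.Nat using (ℕ; zero; suc; _≤_)
open import Data.Bool using (Bool; true; false; _∧_; _∨_; not; if_then_else_)
open import Data.Fin using (Fin; zero; suc; _≟_)
open import Data.Fin.Properties using () renaming (_≟_ to _≟F_)
open import Data.Vec using (Vec; []; _∷_; lookup)
open import Data.List using (List; []; _∷_; concatMap; map; filter; length; allFin)
open import Data.Bool.ListAction using (and; or)
open import Data.Product using (Σ; _,_)
open import Relation.Binary.PropositionalEquality using (_≡_)
open import Relation.Nullary.Decidable using (⌊_⌋)
open import Data.Rational using (ℚ; 0ℚ; _+_; _*_)

record Graph : Set where
  field
    n     : ℕ
    adj   : Fin n → Fin n → Bool
    sym   : ∀ i j → adj i j ≡ adj j i
    irrfl : ∀ i → adj i i ≡ false
open Graph public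

data Reach (G : Graph) : Fin (n G) → Fin (n G) → Set where
  here : ∀ {i} → Reach G i i
  step : ∀ {i j l} → adj G i j ≡ true → Reach G j l → Reach G i l

record Connected (G : Graph) : Set where
  field
    nonempty : 1 ≤ n G
    reach    : ∀ i j → Reach G i j

allVecs : (m k : ℕ) → List (Vec (Fin k) m)
allVecs zero    k = [] ∷ []
allVecs (suc m) k = concatMap (λ x → map (x ∷_) (allVecs m k)) (allFin k)

allSubsets : (m : ℕ) → List (Vec Bool m)
allSubsets zero    = [] ∷ []
allSubsets (suc m) = map (true ∷_) (allSubsets m) Data.List.++ map (false ∷_) (allSubsets m)

allF : ∀ {m} → (Fin m → Bool) → Bool
allF f = and (map f (allFin _))

anyF : ∀ {m} → (Fin m → Bool) → Bool
anyF f = or (map f (allFin _))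

count : ∀ {A : Set} → (A → Bool) → List A → ℕ
count p []       = 0
count p (x ∷ xs) = if p x then suc (count p xs) else count p xs

eqF : ∀ {k} → Fin k → Fin k → Bool
eqF a b = ⌊ a ≟F b ⌋

isProper : (G : Graph) {k : ℕ} → Vec (Fin k) (n G) → Bool
isProper G c = allF λ i → allF λ j →
  not (adj G i j) ∨ not (eqF (lookup c i) (lookup c j))

chromPoly : Graph → ℕ → ℕ
chromPoly G k = count (isProper G) (allVecs (n G) k)

-- the list of proper k-colourings (without repetition); the vertices
-- of C_k(G) are indexed by Fin (numCol G k)
properCols : (G : Graph) (k : ℕ) → List (Vec (Fin k) (n G))
properCols G k = filter (λ c → isProper G c ≟B true) (allVecs (n G) k)
  where open import Data.Bool.Properties using () renaming (_≟_ to _≟B_)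

numCol : Graph → ℕ → ℕ
numCol G k = length (properCols G k)

colour : (G : Graph) (k : ℕ) → Fin (numCol G k) → Vec (Fin k) (n G)
colour G k = Data.List.lookup (properCols G k)

differByOne : ∀ {m k} → Vec (Fin k) m → Vec (Fin k) m → Bool
differByOne {m} c d =
  ⌊ count (λ i → not (eqF (lookup c i) (lookup d i))) (allFin m) Data.Nat.≟ 1 ⌋

colAdj : (G : Graph) (k : ℕ) → Fin (numCol G k) → Fin (numCol G k) → Bool
colAdj G k u w = differByOne (colour G k u) (colour G k w)

-- A subset U of V(C_k(G)) (as a characteristic vector) induces a
-- subgraph isomorphic to H iff there is a map f : V(H) → V(C_k(G))
-- which is injective, has image exactly U, and satisfies
-- adj_H i j = adj_{C_k(G)} (f i) (f j) for all i j.
inducesCopy : (H G : Graph) (k : ℕ) → Vec Bool (numCol G k) → Bool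
inducesCopy H G k U = or (map isIso (allVecs (n H) (numCol G k)))
  where
    isIso : Vec (Fin (numCol G k)) (n H) → Bool
    isIso f =
      (allF λ i → allF λ j → eqF i j ∨ not (eqF (lookup f i) (lookup f j)))
      ∧ (allF λ u → ⌊ Data.Bool._≟_ (lookup U u) (anyF λ i → eqF (lookup f i) u) ⌋)
      ∧ (allF λ i → allF λ j →
           ⌊ Data.Bool._≟_ (adj H i j) (colAdj G k (lookup f i) (lookup f j)) ⌋)

inducedCount : (H G : Graph) → ℕ → ℕ
inducedCount H G k = count (inducesCopy H G k) (allSubsets (numCol G k))

sumℚ : ∀ {r} → (Fin r → ℚ) → ℚ
sumℚ {zero}  f = 0ℚ
sumℚ {suc r} f = f zero + sumℚ (λ i → f (suc i))

ℕtoℚ : ℕ → ℚ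
ℕtoℚ m = Data.Integer.+ m Data.Rational./ 1
  where import Data.Integer

-- Each induced copy of H in C_k(G) is the image of exactly |Aut H| embeddings of H into C_k(G)
-- (precompose any one of them with the automorphisms of H), so π_G^(H)(k)·|Aut H| counts embeddings.
-- An embedding is a family of n_H proper k-colourings of G, i.e. a vector of n_H·n_G colours, and
-- whether such a vector is an embedding depends only on which of its entries coincide. These
-- coincidence patterns are the set partitions of the n_H·n_G positions, encoded by restricted growth
-- strings, and a partition into b blocks is realised by exactly k(k-1)⋯(k-b+1) = π_{K_b}(k) vectors.
-- Hence π_G^(H)(k) = |Aut H|⁻¹ · Σ π_{K_b}(k), summed over the patterns of embeddings.

module Submission where

open import Defs hiding (sym)

-- ℕ arithmetic is opened only inside Counting, so that _*_ in theorem1p1 is multiplication in ℚ.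
module Counting where

  open import Data.Bool using (Bool; true; false; T; _∧_; _∨_; not; if_then_else_)
  open import Data.Bool.ListAction using (and; any)
  open import Data.Bool.Properties
    using (T-∧; T-∨; T-≡; T-not-≡; not-involutive; ∨-assoc; ∨-zeroʳ; ∧-comm) renaming (_≟_ to _≟ᵇ_)
  open import Data.Empty using (⊥; ⊥-elim)
  open import Data.Fin using (Fin; zero; suc; combine)
  open import Data.Fin.Properties using (_≟_; suc-injective; any?; 0≢1+n)
  open import Data.List as List
    using (List; []; _∷_; _++_; [_]; map; concatMap; filter; length; allFin; upTo; tabulate)
  open import Data.List.Properties
    using (map-tabulate; tabulate-lookup; map-applyUpTo; length-++; length-upTo; length-tabulate; map-cong)
  open import Data.List.Membership.Propositional using (lose)
  open import Data.List.Membership.Propositional.Properties using (∈-allFin)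
  import Data.List.Relation.Unary.All as All
  open import Data.List.Relation.Unary.All.Properties using (all⁺; all⁻)
  open import Data.List.Relation.Unary.Any using (satisfied)
  open import Data.List.Relation.Unary.Any.Properties using (any⁺; any⁻)
  open import Data.Nat as ℕ using (ℕ; zero; suc; _+_; _*_; _∸_; _≤_; z≤n; s≤s; _≡ᵇ_)
  open import Data.Nat.Combinatorics.Base using (_P′_)
  open import Data.Nat.Properties
    using (+-assoc; +-comm; +-identityʳ; *-identityʳ; *-zeroʳ; *-comm; *-assoc; *-distribˡ-+; +-mono-≤; m≤n+m;
           ≤-trans; ≤-reflexive; m+n∸m≡n; ≡ᵇ⇒≡; ≡⇒≡ᵇ; +-commutativeSemigroup; module ≤-Reasoning)
  open import Algebra.Properties.CommutativeSemigroup +-commutativeSemigroup using (interchange)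
  open import Data.Product using (∃; _×_; _,_; proj₁; proj₂; map₂)
  open import Data.Sum using (_⊎_; inj₁; inj₂)
  open import Data.Unit using (⊤; tt)
  open import Data.Vec as Vec using (Vec; []; _∷_; lookup)
  open import Data.Vec.Properties
    using (≡-dec; lookup-map; lookup-allFin; lookup-concat; length-toList; lookup-replicate; tabulate-cong;
           tabulate∘lookup; lookup∘tabulate)
  open import Function using (_∘_; id; _⇔_; mk⇔; Equivalence)
  open import Function.Definitions using (Injective)
  open import Relation.Binary.Definitions using (DecidableEquality)
  open import Relation.Binary.PropositionalEquality hiding ([_])
  open import Relation.Nullary using (¬_)
  open import Relation.Nullary.Decidable using (Dec; ⌊_⌋; yes; no; isYes≗does; ⌊⌋-map′; toWitness; fromWitness)

  open Equivalence using (to; from)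

  𝟙 : Bool → ℕ
  𝟙 true  = 1
  𝟙 false = 0

  ∑ : {A : Set} → List A → (A → ℕ) → ℕ
  ∑ []       f = 0
  ∑ (x ∷ xs) f = f x + ∑ xs f

  infix 5 ∑
  syntax ∑ xs (λ x → e) = ∑[ x ∈ xs ] e

  𝟙-∧ : ∀ a b → 𝟙 (a ∧ b) ≡ 𝟙 a * 𝟙 b
  𝟙-∧ true  b = sym (+-identityʳ (𝟙 b))
  𝟙-∧ false b = refl

  𝟙-*-≤ : ∀ a n → 𝟙 a * n ≤ n
  𝟙-*-≤ true  n = ≤-reflexive (+-identityʳ n)
  𝟙-*-≤ false n = z≤n

  𝟙+𝟙-not : ∀ a → 𝟙 a + 𝟙 (not a) ≡ 1
  𝟙+𝟙-not true  = refl
  𝟙+𝟙-not false = refl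

  T-injective : ∀ {a b} → T a ⇔ T b → a ≡ b
  T-injective {false} {false} _   = refl
  T-injective {false} {true}  a⇔b = ⊥-elim (from a⇔b tt)
  T-injective {true}  {false} a⇔b = ⊥-elim (to a⇔b tt)
  T-injective {true}  {true}  _   = refl

  module _ {A : Set} where

    ∑-cong : ∀ xs {f g : A → ℕ} → (∀ x → f x ≡ g x) → ∑ xs f ≡ ∑ xs g
    ∑-cong []       f≗g = refl
    ∑-cong (x ∷ xs) f≗g = cong₂ _+_ (f≗g x) (∑-cong xs f≗g)

    ∑-mono-≤ : ∀ xs {f g : A → ℕ} → (∀ x → f x ≤ g x) → ∑ xs f ≤ ∑ xs g
    ∑-mono-≤ []       f≤g = z≤n
    ∑-mono-≤ (x ∷ xs) f≤g = +-mono-≤ (f≤g x) (∑-mono-≤ xs f≤g)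

    ∑-++ : ∀ xs ys (f : A → ℕ) → ∑ (xs ++ ys) f ≡ ∑ xs f + ∑ ys f
    ∑-++ []       ys f = refl
    ∑-++ (x ∷ xs) ys f = trans (cong (f x +_) (∑-++ xs ys f)) (sym (+-assoc (f x) _ _))

    ∑-+ : ∀ xs (f g : A → ℕ) → ∑[ x ∈ xs ] (f x + g x) ≡ ∑ xs f + ∑ xs g
    ∑-+ []       f g = refl
    ∑-+ (x ∷ xs) f g = trans (cong (f x + g x +_) (∑-+ xs f g)) (interchange (f x) (g x) _ _)

    *-∑ : ∀ c xs (f : A → ℕ) → c * ∑ xs f ≡ ∑[ x ∈ xs ] c * f x
    *-∑ c []       f = *-zeroʳ c
    *-∑ c (x ∷ xs) f = trans (*-distribˡ-+ c (f x) _) (cong (c * f x +_) (*-∑ c xs f))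

    ∑-const : ∀ (xs : List A) c → ∑[ x ∈ xs ] c ≡ length xs * c
    ∑-const []       c = refl
    ∑-const (x ∷ xs) c = cong (c +_) (∑-const xs c)

    ∑-zero : ∀ (xs : List A) → ∑[ x ∈ xs ] 0 ≡ 0
    ∑-zero []       = refl
    ∑-zero (x ∷ xs) = ∑-zero xs

    count≡∑ : ∀ (p : A → Bool) xs → count p xs ≡ ∑[ x ∈ xs ] 𝟙 (p x)
    count≡∑ p []       = refl
    count≡∑ p (x ∷ xs) with p x
    ... | true  = cong suc (count≡∑ p xs)
    ... | false = count≡∑ p xs

    ∑-𝟙-any-false : ∀ (p : A → Bool) xs → any p xs ≡ false → ∑[ x ∈ xs ] 𝟙 (p x) ≡ 0
    ∑-𝟙-any-false p []       _      = refl
    ∑-𝟙-any-false p (x ∷ xs) no-p with p x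
    ... | false = ∑-𝟙-any-false p xs no-p

    ∑-filter : ∀ (p : A → Bool) xs (f : A → ℕ) →
               ∑ (filter (λ x → p x ≟ᵇ true) xs) f ≡ ∑[ x ∈ xs ] 𝟙 (p x) * f x
    ∑-filter p []       f = refl
    ∑-filter p (x ∷ xs) f with p x
    ... | true  = cong₂ _+_ (sym (+-identityʳ (f x))) (∑-filter p xs f)
    ... | false = ∑-filter p xs f

  module _ {A B : Set} where

    ∑-map : ∀ (g : A → B) xs (f : B → ℕ) → ∑ (map g xs) f ≡ ∑ xs (f ∘ g)
    ∑-map g []       f = refl
    ∑-map g (x ∷ xs) f = cong (f (g x) +_) (∑-map g xs f)

    ∑-concatMap : ∀ (g : A → List B) xs (f : B → ℕ) → ∑ (concatMap g xs) f ≡ ∑[ x ∈ xs ] ∑ (g x) f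
    ∑-concatMap g []       f = refl
    ∑-concatMap g (x ∷ xs) f = trans (∑-++ (g x) _ f) (cong (∑ (g x) f +_) (∑-concatMap g xs f))

    ∑-comm : ∀ xs ys (f : A → B → ℕ) → ∑[ x ∈ xs ] ∑[ y ∈ ys ] f x y ≡ ∑[ y ∈ ys ] ∑[ x ∈ xs ] f x y
    ∑-comm []       ys f = sym (∑-zero ys)
    ∑-comm (x ∷ xs) ys f = trans (cong (∑ ys (f x) +_) (∑-comm xs ys f)) (sym (∑-+ ys (f x) _))

  T-⌊⌋ : ∀ {P : Set} (P? : Dec P) → T ⌊ P? ⌋ ⇔ P
  T-⌊⌋ P? = mk⇔ toWitness fromWitness

  T-eqF : ∀ {k} {a b : Fin k} → T (eqF a b) ⇔ a ≡ b
  T-eqF {a = a} {b} = T-⌊⌋ (a ≟ b)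

  eqF-refl : ∀ {k} (a : Fin k) → eqF a a ≡ true
  eqF-refl a = to T-≡ (from T-eqF refl)

  eqF-sym : ∀ {k} (a b : Fin k) → eqF a b ≡ eqF b a
  eqF-sym a b = T-injective (mk⇔ (λ t → from T-eqF (sym (to T-eqF t))) (λ t → from T-eqF (sym (to T-eqF t))))

  T-allF : ∀ {m} {p : Fin m → Bool} → T (allF p) ⇔ (∀ i → T (p i))
  T-allF {m} {p} = mk⇔ (λ t i → All.lookup (all⁺ p (allFin m) t) (∈-allFin i))
                       (λ t → all⁻ p {allFin m} (All.tabulate λ {i} _ → t i))

  T-anyF : ∀ {m} {p : Fin m → Bool} → T (anyF p) ⇔ ∃ λ i → T (p i)
  T-anyF {m} {p} = mk⇔ (λ t → satisfied (any⁻ p (allFin m) t))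
                       (λ (i , t) → any⁺ p (lose (∈-allFin i) t))

  allF-cong : ∀ {m} {p q : Fin m → Bool} → (∀ i → p i ≡ q i) → allF p ≡ allF q
  allF-cong {m} p≗q = cong and (map-cong p≗q (allFin m))

  allF-suc : ∀ {m} (p : Fin (suc m) → Bool) → allF p ≡ p zero ∧ allF (p ∘ suc)
  allF-suc {m} p = cong (λ ps → p zero ∧ and ps) (trans (map-tabulate suc p) (sym (map-tabulate id (p ∘ suc))))

  lookup-ext : ∀ {A : Set} {m} {u v : Vec A m} → (∀ i → lookup u i ≡ lookup v i) → u ≡ v
  lookup-ext {u = u} {v} u≗v = trans (sym (tabulate∘lookup u)) (trans (tabulate-cong u≗v) (tabulate∘lookup v))

  T-∀≡ : ∀ {m} {a b : Fin m → Bool} → T (allF λ u → ⌊ a u ≟ᵇ b u ⌋) ⇔ (∀ u → a u ≡ b u)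
  T-∀≡ = mk⇔ (λ t u → to (T-⌊⌋ _) (to T-allF t u)) (λ a≗b → from T-allF λ u → from (T-⌊⌋ _) (a≗b u))

  T-image : ∀ {c h} (f : Vec (Fin c) h) u → T (anyF λ i → eqF (lookup f i) u) ⇔ ∃ λ i → lookup f i ≡ u
  T-image f u = mk⇔ (λ t → let i , e = to T-anyF t in i , to T-eqF e) (λ (i , e) → from T-anyF (i , from T-eqF e))

  record Enumerates {A : Set} (eq? : DecidableEquality A) (xs : List A) : Set where
    constructor enumerates
    field once : ∀ a → ∑[ x ∈ xs ] 𝟙 ⌊ eq? x a ⌋ ≡ 1
  open Enumerates

  module _ {A : Set} {eq? : DecidableEquality A} {xs : List A} (enum : Enumerates eq? xs) where

    ∑-select : ∀ a (f : A → ℕ) → ∑[ x ∈ xs ] 𝟙 ⌊ eq? x a ⌋ * f x ≡ f a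
    ∑-select a f = begin
      ∑[ x ∈ xs ] 𝟙 ⌊ eq? x a ⌋ * f x  ≡⟨ ∑-cong xs at-a ⟩
      ∑[ x ∈ xs ] f a * 𝟙 ⌊ eq? x a ⌋  ≡⟨ *-∑ (f a) xs _ ⟨
      f a * (∑[ x ∈ xs ] 𝟙 ⌊ eq? x a ⌋) ≡⟨ cong (f a *_) (once enum a) ⟩
      f a * 1                          ≡⟨ *-identityʳ (f a) ⟩
      f a                              ∎
      where
      open ≡-Reasoning
      at-a : ∀ x → 𝟙 ⌊ eq? x a ⌋ * f x ≡ f a * 𝟙 ⌊ eq? x a ⌋
      at-a x with eq? x a
      ... | yes refl = *-comm 1 (f x)
      ... | no _     = sym (*-zeroʳ (f a))

  graph⊆transpose : ∀ {A B : Set} (eqA? : DecidableEquality A) (eqB? : DecidableEquality B) {p : A → Bool} {q : B → Bool}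
                    (φ : A → B) (ψ : B → A) → (∀ a → T (p a) → T (q (φ a)) × ψ (φ a) ≡ a) →
                    ∀ x y → T (⌊ eqB? y (φ x) ⌋ ∧ p x) → T (⌊ eqA? x (ψ y) ⌋ ∧ q y)
  graph⊆transpose eqA? eqB? φ ψ φ-ok x y t with refl ← to (T-⌊⌋ (eqB? y (φ x))) (proj₁ (to T-∧ t)) =
    let q[φx] , ψφx≡x = φ-ok x (proj₂ (to T-∧ t))
    in from T-∧ (from (T-⌊⌋ (eqA? x (ψ y))) (sym ψφx≡x) , q[φx])

  module _ {A B : Set} {eqA? : DecidableEquality A} {eqB? : DecidableEquality B} {p : A → Bool} {q : B → Bool} where

    ∑-bijection : ∀ {xs ys} → Enumerates eqA? xs → Enumerates eqB? ys → (φ : A → B) (ψ : B → A) →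
                  (∀ a → T (p a) → T (q (φ a)) × ψ (φ a) ≡ a) →
                  (∀ b → T (q b) → T (p (ψ b)) × φ (ψ b) ≡ b) →
                  ∑[ x ∈ xs ] 𝟙 (p x) ≡ ∑[ y ∈ ys ] 𝟙 (q y)
    ∑-bijection {xs} {ys} enumA enumB φ ψ φ-ok ψ-ok = begin
      ∑[ x ∈ xs ] 𝟙 (p x)                                     ≡⟨ ∑-cong xs (λ x → ∑-select enumB (φ x) (λ _ → 𝟙 (p x))) ⟨
      ∑[ x ∈ xs ] ∑[ y ∈ ys ] 𝟙 ⌊ eqB? y (φ x) ⌋ * 𝟙 (p x)  ≡⟨ ∑-comm xs ys _ ⟩
      ∑[ y ∈ ys ] ∑[ x ∈ xs ] 𝟙 ⌊ eqB? y (φ x) ⌋ * 𝟙 (p x)  ≡⟨ ∑-cong ys (λ y → ∑-cong xs (λ x → graph-sym x y)) ⟩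
      ∑[ y ∈ ys ] ∑[ x ∈ xs ] 𝟙 ⌊ eqA? x (ψ y) ⌋ * 𝟙 (q y)  ≡⟨ ∑-cong ys (λ y → ∑-select enumA (ψ y) (λ _ → 𝟙 (q y))) ⟩
      ∑[ y ∈ ys ] 𝟙 (q y)                                     ∎
      where
      open ≡-Reasoning
      graph-sym : ∀ x y → 𝟙 ⌊ eqB? y (φ x) ⌋ * 𝟙 (p x) ≡ 𝟙 ⌊ eqA? x (ψ y) ⌋ * 𝟙 (q y)
      graph-sym x y = begin
        𝟙 ⌊ eqB? y (φ x) ⌋ * 𝟙 (p x)
          ≡⟨ 𝟙-∧ ⌊ eqB? y (φ x) ⌋ (p x) ⟨
        𝟙 (⌊ eqB? y (φ x) ⌋ ∧ p x)
          ≡⟨ cong 𝟙 (T-injective (mk⇔ (graph⊆transpose eqA? eqB? φ ψ φ-ok x y) (graph⊆transpose eqB? eqA? ψ φ ψ-ok y x))) ⟩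
        𝟙 (⌊ eqA? x (ψ y) ⌋ ∧ q y)
          ≡⟨ 𝟙-∧ ⌊ eqA? x (ψ y) ⌋ (q y) ⟩
        𝟙 ⌊ eqA? x (ψ y) ⌋ * 𝟙 (q y) ∎

  allFin-enumerates : ∀ k → Enumerates _≟_ (allFin k)
  allFin-enumerates k = enumerates (go k)
    where
    go : ∀ k (a : Fin k) → ∑[ y ∈ allFin k ] 𝟙 ⌊ y ≟ a ⌋ ≡ 1
    go (suc k) a = begin
      𝟙 ⌊ zero ≟ a ⌋ + (∑[ y ∈ tabulate suc ] 𝟙 ⌊ y ≟ a ⌋)
        ≡⟨ cong (λ ys → 𝟙 ⌊ zero ≟ a ⌋ + (∑[ y ∈ ys ] 𝟙 ⌊ y ≟ a ⌋)) (map-tabulate id suc) ⟨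
      𝟙 ⌊ zero ≟ a ⌋ + (∑[ y ∈ map suc (allFin k) ] 𝟙 ⌊ y ≟ a ⌋)
        ≡⟨ cong (𝟙 ⌊ zero ≟ a ⌋ +_) (∑-map suc (allFin k) _) ⟩
      𝟙 ⌊ zero ≟ a ⌋ + (∑[ y ∈ allFin k ] 𝟙 ⌊ suc y ≟ a ⌋)
        ≡⟨ shifted a ⟩
      1 ∎
      where
      open ≡-Reasoning
      shifted : ∀ a → 𝟙 ⌊ zero ≟ a ⌋ + (∑[ y ∈ allFin k ] 𝟙 ⌊ suc y ≟ a ⌋) ≡ 1
      shifted zero    = cong suc (∑-zero (allFin k))
      shifted (suc c) = trans (∑-cong (allFin k) (λ y → cong 𝟙 (⌊⌋-map′ (cong suc) suc-injective (y ≟ c)))) (go k c)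

  ⌊∷≟∷⌋ : ∀ {A : Set} {m} (eq? : DecidableEquality A) x y (u v : Vec A m) →
          ⌊ ≡-dec eq? (x ∷ u) (y ∷ v) ⌋ ≡ ⌊ eq? x y ⌋ ∧ ⌊ ≡-dec eq? u v ⌋
  ⌊∷≟∷⌋ eq? x y u v = trans (isYes≗does _) (sym (cong₂ _∧_ (isYes≗does (eq? x y)) (isYes≗does (≡-dec eq? u v))))

  ∑-∷-≟ : ∀ {A : Set} {m} {eq? : DecidableEquality A} {us : List (Vec A m)} → Enumerates (≡-dec eq?) us →
          ∀ x y v → ∑[ u ∈ us ] 𝟙 ⌊ ≡-dec eq? (x ∷ u) (y ∷ v) ⌋ ≡ 𝟙 ⌊ eq? x y ⌋
  ∑-∷-≟ {eq? = eq?} {us} enum x y v = begin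
    ∑[ u ∈ us ] 𝟙 ⌊ ≡-dec eq? (x ∷ u) (y ∷ v) ⌋
      ≡⟨ ∑-cong us (λ u → trans (cong 𝟙 (⌊∷≟∷⌋ eq? x y u v)) (𝟙-∧ ⌊ eq? x y ⌋ _)) ⟩
    ∑[ u ∈ us ] 𝟙 ⌊ eq? x y ⌋ * 𝟙 ⌊ ≡-dec eq? u v ⌋
      ≡⟨ *-∑ (𝟙 ⌊ eq? x y ⌋) us (λ u → 𝟙 ⌊ ≡-dec eq? u v ⌋) ⟨
    𝟙 ⌊ eq? x y ⌋ * (∑[ u ∈ us ] 𝟙 ⌊ ≡-dec eq? u v ⌋)
      ≡⟨ cong (𝟙 ⌊ eq? x y ⌋ *_) (once enum v) ⟩
    𝟙 ⌊ eq? x y ⌋ * 1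
      ≡⟨ *-identityʳ (𝟙 ⌊ eq? x y ⌋) ⟩
    𝟙 ⌊ eq? x y ⌋ ∎
    where open ≡-Reasoning

  allSubsets-enumerates : ∀ m → Enumerates (≡-dec _≟ᵇ_) (allSubsets m)
  allSubsets-enumerates m = enumerates (go m)
    where
    go : ∀ m (V : Vec Bool m) → ∑[ U ∈ allSubsets m ] 𝟙 ⌊ ≡-dec _≟ᵇ_ U V ⌋ ≡ 1
    go zero    []      = refl
    go (suc m) (b ∷ V) = begin
      ∑ (map (true ∷_) (allSubsets m) ++ map (false ∷_) (allSubsets m)) is-bV
        ≡⟨ ∑-++ (map (true ∷_) (allSubsets m)) _ is-bV ⟩
      ∑ (map (true ∷_) (allSubsets m)) is-bV + ∑ (map (false ∷_) (allSubsets m)) is-bV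
        ≡⟨ cong₂ _+_ (∑-map (true ∷_) (allSubsets m) is-bV) (∑-map (false ∷_) (allSubsets m) is-bV) ⟩
      (∑[ U ∈ allSubsets m ] 𝟙 ⌊ ≡-dec _≟ᵇ_ (true ∷ U) (b ∷ V) ⌋) + (∑[ U ∈ allSubsets m ] 𝟙 ⌊ ≡-dec _≟ᵇ_ (false ∷ U) (b ∷ V) ⌋)
        ≡⟨ cong₂ _+_ (∑-∷-≟ subsets true b V) (∑-∷-≟ subsets false b V) ⟩
      𝟙 ⌊ true ≟ᵇ b ⌋ + 𝟙 ⌊ false ≟ᵇ b ⌋
        ≡⟨ one-of b ⟩
      1 ∎
      where
      open ≡-Reasoning
      is-bV : Vec Bool (suc m) → ℕ
      is-bV U = 𝟙 ⌊ ≡-dec _≟ᵇ_ U (b ∷ V) ⌋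
      subsets : Enumerates (≡-dec _≟ᵇ_) (allSubsets m)
      subsets = enumerates (go m)
      one-of : ∀ b → 𝟙 ⌊ true ≟ᵇ b ⌋ + 𝟙 ⌊ false ≟ᵇ b ⌋ ≡ 1
      one-of true  = refl
      one-of false = refl

  vecsOf : {A : Set} (m : ℕ) → List A → List (Vec A m)
  vecsOf zero    xs = [ [] ]
  vecsOf (suc m) xs = concatMap (λ x → map (x ∷_) (vecsOf m xs)) xs

  allVecs≡vecsOf : ∀ m k → allVecs m k ≡ vecsOf m (allFin k)
  allVecs≡vecsOf zero    k = refl
  allVecs≡vecsOf (suc m) k = cong (λ vs → concatMap (λ x → map (x ∷_) vs) (allFin k)) (allVecs≡vecsOf m k)

  ∑-vecsOf-suc : ∀ {A : Set} m (xs : List A) (f : Vec A (suc m) → ℕ) →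
                 ∑ (vecsOf (suc m) xs) f ≡ ∑[ x ∈ xs ] ∑[ v ∈ vecsOf m xs ] f (x ∷ v)
  ∑-vecsOf-suc m xs f = trans (∑-concatMap _ xs f) (∑-cong xs (λ x → ∑-map (x ∷_) (vecsOf m xs) f))

  module _ {A : Set} where

    vecsOf-enumerates : ∀ {eq? : DecidableEquality A} {xs} → Enumerates eq? xs → ∀ m → Enumerates (≡-dec eq?) (vecsOf m xs)
    vecsOf-enumerates {eq?} {xs} enum m = enumerates (go m)
      where
      go : ∀ m (v : Vec A m) → ∑[ u ∈ vecsOf m xs ] 𝟙 ⌊ ≡-dec eq? u v ⌋ ≡ 1
      go zero    []      = refl
      go (suc m) (y ∷ v) = begin
        ∑ (vecsOf (suc m) xs) (λ u → 𝟙 ⌊ ≡-dec eq? u (y ∷ v) ⌋)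
          ≡⟨ ∑-vecsOf-suc m xs _ ⟩
        ∑[ x ∈ xs ] ∑[ u ∈ vecsOf m xs ] 𝟙 ⌊ ≡-dec eq? (x ∷ u) (y ∷ v) ⌋
          ≡⟨ ∑-cong xs (λ x → ∑-∷-≟ {eq? = eq?} {us = vecsOf m xs} (enumerates (go m)) x y v) ⟩
        ∑[ x ∈ xs ] 𝟙 ⌊ eq? x y ⌋
          ≡⟨ once enum y ⟩
        1 ∎
        where open ≡-Reasoning

    ∑-vecsOf-+ : ∀ a b (xs : List A) (f : Vec A (a + b) → ℕ) →
                 ∑ (vecsOf (a + b) xs) f ≡ ∑[ u ∈ vecsOf a xs ] ∑[ v ∈ vecsOf b xs ] f (u Vec.++ v)
    ∑-vecsOf-+ zero    b xs f = sym (+-identityʳ _)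
    ∑-vecsOf-+ (suc a) b xs f = begin
      ∑ (vecsOf (suc a + b) xs) f
        ≡⟨ ∑-vecsOf-suc (a + b) xs f ⟩
      ∑[ x ∈ xs ] ∑[ w ∈ vecsOf (a + b) xs ] f (x ∷ w)
        ≡⟨ ∑-cong xs (λ x → ∑-vecsOf-+ a b xs (f ∘ (x ∷_))) ⟩
      ∑[ x ∈ xs ] ∑[ u ∈ vecsOf a xs ] ∑[ v ∈ vecsOf b xs ] f (x ∷ u Vec.++ v)
        ≡⟨ ∑-vecsOf-suc a xs (λ u → ∑[ v ∈ vecsOf b xs ] f (u Vec.++ v)) ⟨
      ∑[ u ∈ vecsOf (suc a) xs ] ∑[ v ∈ vecsOf b xs ] f (u Vec.++ v) ∎
      where open ≡-Reasoning

    ∑-vecsOf-concat : ∀ h m (xs : List A) (f : Vec A (h * m) → ℕ) →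
                      ∑[ T ∈ vecsOf h (vecsOf m xs) ] f (Vec.concat T) ≡ ∑ (vecsOf (h * m) xs) f
    ∑-vecsOf-concat zero    m xs f = refl
    ∑-vecsOf-concat (suc h) m xs f = begin
      ∑[ T ∈ vecsOf (suc h) (vecsOf m xs) ] f (Vec.concat T)
        ≡⟨ ∑-vecsOf-suc h (vecsOf m xs) _ ⟩
      ∑[ u ∈ vecsOf m xs ] ∑[ T ∈ vecsOf h (vecsOf m xs) ] f (u Vec.++ Vec.concat T)
        ≡⟨ ∑-cong (vecsOf m xs) (λ u → ∑-vecsOf-concat h m xs (f ∘ (u Vec.++_))) ⟩
      ∑[ u ∈ vecsOf m xs ] ∑[ v ∈ vecsOf (h * m) xs ] f (u Vec.++ v)
        ≡⟨ ∑-vecsOf-+ m (h * m) xs f ⟨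
      ∑ (vecsOf (suc h * m) xs) f ∎
      where open ≡-Reasoning

    ∑-vecsOf-filter : ∀ m (p : A → Bool) xs (f : Vec A m → ℕ) →
                      ∑ (vecsOf m (filter (λ x → p x ≟ᵇ true) xs)) f ≡ ∑[ v ∈ vecsOf m xs ] 𝟙 (allF λ i → p (lookup v i)) * f v
    ∑-vecsOf-filter zero    p xs f = cong (_+ 0) (sym (+-identityʳ (f [])))
    ∑-vecsOf-filter (suc m) p xs f = begin
      ∑ (vecsOf (suc m) ys) f
        ≡⟨ ∑-vecsOf-suc m ys f ⟩
      ∑[ x ∈ ys ] ∑[ v ∈ vecsOf m ys ] f (x ∷ v)
        ≡⟨ ∑-cong ys (λ x → ∑-vecsOf-filter m p xs (f ∘ (x ∷_))) ⟩
      ∑[ x ∈ ys ] ∑[ v ∈ vecsOf m xs ] 𝟙 (all v) * f (x ∷ v)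
        ≡⟨ ∑-filter p xs _ ⟩
      ∑[ x ∈ xs ] 𝟙 (p x) * (∑[ v ∈ vecsOf m xs ] 𝟙 (all v) * f (x ∷ v))
        ≡⟨ ∑-cong xs (λ x → *-∑ (𝟙 (p x)) (vecsOf m xs) _) ⟩
      ∑[ x ∈ xs ] ∑[ v ∈ vecsOf m xs ] 𝟙 (p x) * (𝟙 (all v) * f (x ∷ v))
        ≡⟨ ∑-cong xs (λ x → ∑-cong (vecsOf m xs) (λ v → regroup x v)) ⟩
      ∑[ x ∈ xs ] ∑[ v ∈ vecsOf m xs ] 𝟙 (all (x ∷ v)) * f (x ∷ v)
        ≡⟨ ∑-vecsOf-suc m xs _ ⟨
      ∑[ v ∈ vecsOf (suc m) xs ] 𝟙 (all v) * f v ∎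
      where
      open ≡-Reasoning
      ys = filter (λ x → p x ≟ᵇ true) xs
      all : ∀ {m} → Vec A m → Bool
      all v = allF λ i → p (lookup v i)
      regroup : ∀ x v → 𝟙 (p x) * (𝟙 (all v) * f (x ∷ v)) ≡ 𝟙 (all (x ∷ v)) * f (x ∷ v)
      regroup x v = begin
        𝟙 (p x) * (𝟙 (all v) * f (x ∷ v))  ≡⟨ *-assoc (𝟙 (p x)) _ _ ⟨
        𝟙 (p x) * 𝟙 (all v) * f (x ∷ v)    ≡⟨ cong (_* f (x ∷ v)) (𝟙-∧ (p x) (all v)) ⟨
        𝟙 (p x ∧ all v) * f (x ∷ v)        ≡⟨ cong (λ b → 𝟙 b * f (x ∷ v)) (allF-suc (λ i → p (lookup (x ∷ v) i))) ⟨
        𝟙 (all (x ∷ v)) * f (x ∷ v)        ∎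

    ∑-vecsOf-map : ∀ {B : Set} m (g : A → B) xs (f : Vec B m → ℕ) →
                   ∑ (vecsOf m (map g xs)) f ≡ ∑[ v ∈ vecsOf m xs ] f (Vec.map g v)
    ∑-vecsOf-map zero    g xs f = refl
    ∑-vecsOf-map (suc m) g xs f = begin
      ∑ (vecsOf (suc m) (map g xs)) f
        ≡⟨ ∑-vecsOf-suc m (map g xs) f ⟩
      ∑[ y ∈ map g xs ] ∑[ w ∈ vecsOf m (map g xs) ] f (y ∷ w)
        ≡⟨ ∑-map g xs _ ⟩
      ∑[ x ∈ xs ] ∑[ w ∈ vecsOf m (map g xs) ] f (g x ∷ w)
        ≡⟨ ∑-cong xs (λ x → ∑-vecsOf-map m g xs (f ∘ (g x ∷_))) ⟩
      ∑[ x ∈ xs ] ∑[ v ∈ vecsOf m xs ] f (g x ∷ Vec.map g v)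
        ≡⟨ ∑-vecsOf-suc m xs _ ⟨
      ∑[ v ∈ vecsOf (suc m) xs ] f (Vec.map g v) ∎
      where open ≡-Reasoning

  module _ {A : Set} (eq? : DecidableEquality A) where

    private
      two≰one : ¬ (2 ≤ 1)
      two≰one (s≤s ())

      repeated : ∀ x xs → 1 ≤ ∑[ y ∈ xs ] 𝟙 ⌊ eq? y x ⌋ → 2 ≤ ∑[ y ∈ x ∷ xs ] 𝟙 ⌊ eq? y x ⌋
      repeated x xs occ with eq? x x
      ... | yes _  = s≤s occ
      ... | no x≢x = ⊥-elim (x≢x refl)

      occurs-lookup : ∀ xs i → 1 ≤ ∑[ y ∈ xs ] 𝟙 ⌊ eq? y (List.lookup xs i) ⌋
      occurs-lookup (x ∷ xs) zero with eq? x x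
      ... | yes _  = s≤s z≤n
      ... | no x≢x = ⊥-elim (x≢x refl)
      occurs-lookup (x ∷ xs) (suc i) = ≤-trans (occurs-lookup xs i) (m≤n+m _ _)

    lookup-injective : ∀ xs → (∀ a → ∑[ x ∈ xs ] 𝟙 ⌊ eq? x a ⌋ ≤ 1) →
                       ∀ i j → List.lookup xs i ≡ List.lookup xs j → i ≡ j
    lookup-injective (x ∷ xs) once≤ zero    zero    _ = refl
    lookup-injective (x ∷ xs) once≤ zero    (suc j) e =
      ⊥-elim (two≰one (≤-trans (repeated x xs (subst (λ a → 1 ≤ ∑[ y ∈ xs ] 𝟙 ⌊ eq? y a ⌋) (sym e) (occurs-lookup xs j))) (once≤ x)))
    lookup-injective (x ∷ xs) once≤ (suc i) zero    e = sym (lookup-injective (x ∷ xs) once≤ zero (suc i) (sym e))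
    lookup-injective (x ∷ xs) once≤ (suc i) (suc j) e =
      cong suc (lookup-injective xs (λ a → ≤-trans (m≤n+m _ _) (once≤ a)) i j e)

    filter-at-most-once : ∀ {xs} → Enumerates eq? xs → (p : A → Bool) →
                          ∀ a → ∑[ x ∈ filter (λ x → p x ≟ᵇ true) xs ] 𝟙 ⌊ eq? x a ⌋ ≤ 1
    filter-at-most-once {xs} enum p a = begin
      ∑[ x ∈ filter (λ x → p x ≟ᵇ true) xs ] 𝟙 ⌊ eq? x a ⌋  ≡⟨ ∑-filter p xs _ ⟩
      ∑[ x ∈ xs ] 𝟙 (p x) * 𝟙 ⌊ eq? x a ⌋                   ≤⟨ ∑-mono-≤ xs (λ x → 𝟙-*-≤ (p x) _) ⟩
      ∑[ x ∈ xs ] 𝟙 ⌊ eq? x a ⌋                             ≡⟨ once enum a ⟩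
      1                                                      ∎
      where open ≤-Reasoning

  allVecs-enumerates : ∀ m k → Enumerates (≡-dec _≟_) (allVecs m k)
  allVecs-enumerates m k = subst (Enumerates (≡-dec _≟_)) (sym (allVecs≡vecsOf m k)) (vecsOf-enumerates (allFin-enumerates k) m)

  colour-injective : ∀ G k i j → colour G k i ≡ colour G k j → i ≡ j
  colour-injective G k = lookup-injective (≡-dec _≟_) (properCols G k)
    (filter-at-most-once (≡-dec _≟_) (allVecs-enumerates (n G) k) (isProper G))

  infix 4.5 _∈ᵇ_

  _∈ᵇ_ : ∀ {k} → Fin k → List (Fin k) → Bool
  y ∈ᵇ []     = false
  y ∈ᵇ v ∷ vs = eqF y v ∨ (y ∈ᵇ vs)

  -- When y does not occur in vs this is length vs, the position y gets when appended to vs.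
  position : ∀ {k} → Fin k → List (Fin k) → ℕ
  position y []       = 0
  position y (v ∷ vs) = if eqF y v then 0 else suc (position y vs)

  Distinct : ∀ {k} → List (Fin k) → Set
  Distinct []       = ⊤
  Distinct (v ∷ vs) = v ∈ᵇ vs ≡ false × Distinct vs

  module _ {k : ℕ} where

    ∈ᵇ-++ : ∀ (y : Fin k) V W → y ∈ᵇ V ++ W ≡ (y ∈ᵇ V) ∨ (y ∈ᵇ W)
    ∈ᵇ-++ y []      W = refl
    ∈ᵇ-++ y (v ∷ V) W = trans (cong (eqF y v ∨_) (∈ᵇ-++ y V W)) (sym (∨-assoc (eqF y v) _ _))

    position-++ : ∀ (y : Fin k) V W → y ∈ᵇ V ≡ true → position y (V ++ W) ≡ position y V
    position-++ y (v ∷ V) W y∈V with eqF y v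
    ... | true  = refl
    ... | false = cong suc (position-++ y V W y∈V)

    position-absent : ∀ (y : Fin k) V → y ∈ᵇ V ≡ false → position y V ≡ length V
    position-absent y []      _   = refl
    position-absent y (v ∷ V) y∉V with eqF y v
    ... | false = cong suc (position-absent y V y∉V)

    position-∷ʳ : ∀ (y : Fin k) V → y ∈ᵇ V ≡ false → position y (V ++ [ y ]) ≡ length V
    position-∷ʳ y []      _   rewrite eqF-refl y = refl
    position-∷ʳ y (v ∷ V) y∉V with eqF y v
    ... | false = cong suc (position-∷ʳ y V y∉V)

    position-injective : ∀ (y z : Fin k) V → y ∈ᵇ V ≡ true → z ∈ᵇ V ≡ true → position y V ≡ position z V → y ≡ z
    position-injective y z (v ∷ V) y∈V z∈V eq with eqF y v in y≟v | eqF z v in z≟v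
    ... | true  | true  = trans (to T-eqF (from T-≡ y≟v)) (sym (to T-eqF (from T-≡ z≟v)))
    ... | false | false = position-injective y z V y∈V z∈V (cong ℕ.pred eq)

    Distinct-∷ʳ : ∀ (y : Fin k) V → Distinct V → y ∈ᵇ V ≡ false → Distinct (V ++ [ y ])
    Distinct-∷ʳ y []      _            _   = refl , tt
    Distinct-∷ʳ y (v ∷ V) (v∉V , dV) y∉vV with eqF y v in y≟v
    ... | false = v∉V++y , Distinct-∷ʳ y V dV y∉vV
      where
      v∉V++y : v ∈ᵇ V ++ [ y ] ≡ false
      v∉V++y = begin
        v ∈ᵇ V ++ [ y ]             ≡⟨ ∈ᵇ-++ v V [ y ] ⟩
        (v ∈ᵇ V) ∨ (eqF v y ∨ false) ≡⟨ cong₂ (λ a b → a ∨ (b ∨ false)) v∉V (trans (eqF-sym v y) y≟v) ⟩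
        false                       ∎
        where open ≡-Reasoning

  ∑-upTo-suc : ∀ n (g : ℕ → ℕ) → ∑ (upTo (suc n)) g ≡ g 0 + (∑[ l ∈ upTo n ] g (suc l))
  ∑-upTo-suc n g = cong (g 0 +_) (trans (cong (λ ls → ∑ ls g) (sym (map-applyUpTo id suc n))) (∑-map suc (upTo n) g))

  if≡𝟙-sum : ∀ b (x y : ℕ) → (if b then x else y) ≡ 𝟙 b * x + 𝟙 (not b) * y
  if≡𝟙-sum true  x y = sym (trans (+-identityʳ _) (+-identityʳ x))
  if≡𝟙-sum false x y = sym (+-identityʳ y)

  module _ {k : ℕ} where

    ∑-present : ∀ (V : List (Fin k)) → Distinct V → (g : ℕ → ℕ) →
                ∑[ y ∈ allFin k ] 𝟙 (y ∈ᵇ V) * g (position y V) ≡ ∑[ l ∈ upTo (length V) ] g l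
    ∑-present []      _          g = ∑-zero (allFin k)
    ∑-present (v ∷ V) (v∉V , dV) g = begin
      ∑[ y ∈ allFin k ] 𝟙 (y ∈ᵇ v ∷ V) * g (position y (v ∷ V))
        ≡⟨ ∑-cong (allFin k) split ⟩
      ∑[ y ∈ allFin k ] (𝟙 (eqF y v) * g 0 + 𝟙 (y ∈ᵇ V) * g (suc (position y V)))
        ≡⟨ ∑-+ (allFin k) _ _ ⟩
      (∑[ y ∈ allFin k ] 𝟙 (eqF y v) * g 0) + (∑[ y ∈ allFin k ] 𝟙 (y ∈ᵇ V) * g (suc (position y V)))
        ≡⟨ cong₂ _+_ (∑-select (allFin-enumerates k) v (λ _ → g 0)) (∑-present V dV (g ∘ suc)) ⟩
      g 0 + (∑[ l ∈ upTo (length V) ] g (suc l))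
        ≡⟨ ∑-upTo-suc (length V) g ⟨
      ∑[ l ∈ upTo (length (v ∷ V)) ] g l ∎
      where
      open ≡-Reasoning
      split : ∀ y → 𝟙 (y ∈ᵇ v ∷ V) * g (position y (v ∷ V)) ≡ 𝟙 (eqF y v) * g 0 + 𝟙 (y ∈ᵇ V) * g (suc (position y V))
      split y with eqF y v in y≟v
      ... | false = refl
      ... | true with refl ← to T-eqF (from T-≡ y≟v) rewrite v∉V = sym (+-identityʳ _)

    count-absent : ∀ (V : List (Fin k)) → Distinct V → ∑[ y ∈ allFin k ] 𝟙 (not (y ∈ᵇ V)) ≡ k ∸ length V
    count-absent V dV = begin
      absent                                        ≡⟨ m+n∸m≡n (length V) absent ⟨
      (length V + absent) ∸ length V                ≡⟨ cong (_∸ length V) total ⟩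
      k ∸ length V                                  ∎
      where
      open ≡-Reasoning
      absent = ∑[ y ∈ allFin k ] 𝟙 (not (y ∈ᵇ V))
      present : ∑[ y ∈ allFin k ] 𝟙 (y ∈ᵇ V) ≡ length V
      present = begin
        ∑[ y ∈ allFin k ] 𝟙 (y ∈ᵇ V)                 ≡⟨ ∑-cong (allFin k) (λ y → *-identityʳ (𝟙 (y ∈ᵇ V))) ⟨
        ∑[ y ∈ allFin k ] 𝟙 (y ∈ᵇ V) * 1             ≡⟨ ∑-present V dV (λ _ → 1) ⟩
        ∑[ l ∈ upTo (length V) ] 1                    ≡⟨ ∑-const (upTo (length V)) 1 ⟩
        length (upTo (length V)) * 1                  ≡⟨ trans (*-identityʳ _) (length-upTo (length V)) ⟩
        length V                                      ∎
      total : length V + absent ≡ k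
      total = begin
        length V + absent                                             ≡⟨ cong (_+ absent) present ⟨
        (∑[ y ∈ allFin k ] 𝟙 (y ∈ᵇ V)) + absent                       ≡⟨ ∑-+ (allFin k) _ _ ⟨
        ∑[ y ∈ allFin k ] (𝟙 (y ∈ᵇ V) + 𝟙 (not (y ∈ᵇ V)))             ≡⟨ ∑-cong (allFin k) (λ y → 𝟙+𝟙-not (y ∈ᵇ V)) ⟩
        ∑[ y ∈ allFin k ] 1                                           ≡⟨ ∑-const (allFin k) 1 ⟩
        length (allFin k) * 1                                         ≡⟨ trans (*-identityʳ _) (length-tabulate {n = k} id) ⟩
        k                                                             ∎

    ∑-by-membership : ∀ (V : List (Fin k)) → Distinct V → (g : ℕ → ℕ) (c : ℕ) →
                      ∑[ y ∈ allFin k ] (if y ∈ᵇ V then g (position y V) else c)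
                        ≡ (∑[ l ∈ upTo (length V) ] g l) + (k ∸ length V) * c
    ∑-by-membership V dV g c = begin
      ∑[ y ∈ allFin k ] (if y ∈ᵇ V then g (position y V) else c)
        ≡⟨ ∑-cong (allFin k) (λ y → if≡𝟙-sum (y ∈ᵇ V) _ c) ⟩
      ∑[ y ∈ allFin k ] (𝟙 (y ∈ᵇ V) * g (position y V) + 𝟙 (not (y ∈ᵇ V)) * c)
        ≡⟨ ∑-+ (allFin k) _ _ ⟩
      (∑[ y ∈ allFin k ] 𝟙 (y ∈ᵇ V) * g (position y V)) + (∑[ y ∈ allFin k ] 𝟙 (not (y ∈ᵇ V)) * c)
        ≡⟨ cong₂ _+_ (∑-present V dV g) absent-part ⟩
      (∑[ l ∈ upTo (length V) ] g l) + (k ∸ length V) * c ∎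
      where
      open ≡-Reasoning
      absent-part : ∑[ y ∈ allFin k ] 𝟙 (not (y ∈ᵇ V)) * c ≡ (k ∸ length V) * c
      absent-part = begin
        ∑[ y ∈ allFin k ] 𝟙 (not (y ∈ᵇ V)) * c       ≡⟨ ∑-cong (allFin k) (λ y → *-comm (𝟙 (not (y ∈ᵇ V))) c) ⟩
        ∑[ y ∈ allFin k ] c * 𝟙 (not (y ∈ᵇ V))       ≡⟨ *-∑ c (allFin k) _ ⟨
        c * (∑[ y ∈ allFin k ] 𝟙 (not (y ∈ᵇ V)))     ≡⟨ cong (c *_) (count-absent V dV) ⟩
        c * (k ∸ length V)                            ≡⟨ *-comm c _ ⟩
        (k ∸ length V) * c                            ∎

  -- The colours of x in order of first occurrence, reading x from the right.
  values : ∀ {k N} → Vec (Fin k) N → List (Fin k)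
  values []      = []
  values (y ∷ x) = if y ∈ᵇ values x then values x else values x ++ [ y ]

  rgs : ∀ {k N} → Vec (Fin k) N → Vec ℕ N
  rgs []      = []
  rgs (y ∷ x) = position y (values x) ∷ rgs x

  module _ {k : ℕ} where

    values-distinct : ∀ {N} (x : Vec (Fin k) N) → Distinct (values x)
    values-distinct []      = tt
    values-distinct (y ∷ x) with y ∈ᵇ values x in y∈?
    ... | true  = values-distinct x
    ... | false = Distinct-∷ʳ y (values x) (values-distinct x) y∈?

    ∈ᵇ-values : ∀ {N} (x : Vec (Fin k) N) a → lookup x a ∈ᵇ values x ≡ true
    ∈ᵇ-values (y ∷ x) a with y ∈ᵇ values x in y∈?
    ∈ᵇ-values (y ∷ x) zero    | true  = y∈?
    ∈ᵇ-values (y ∷ x) (suc a) | true  = ∈ᵇ-values x a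
    ∈ᵇ-values (y ∷ x) zero    | false = begin
      y ∈ᵇ values x ++ [ y ]              ≡⟨ ∈ᵇ-++ y (values x) [ y ] ⟩
      (y ∈ᵇ values x) ∨ (eqF y y ∨ false) ≡⟨ cong (λ b → (y ∈ᵇ values x) ∨ (b ∨ false)) (eqF-refl y) ⟩
      (y ∈ᵇ values x) ∨ true              ≡⟨ ∨-zeroʳ (y ∈ᵇ values x) ⟩
      true                                ∎
      where open ≡-Reasoning
    ∈ᵇ-values (y ∷ x) (suc a) | false = trans (∈ᵇ-++ (lookup x a) (values x) [ y ]) (cong (_∨ (lookup x a ∈ᵇ [ y ])) (∈ᵇ-values x a))

    lookup-rgs : ∀ {N} (x : Vec (Fin k) N) a → lookup (rgs x) a ≡ position (lookup x a) (values x)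
    lookup-rgs (y ∷ x) a with y ∈ᵇ values x in y∈?
    lookup-rgs (y ∷ x) zero    | true  = refl
    lookup-rgs (y ∷ x) (suc a) | true  = lookup-rgs x a
    lookup-rgs (y ∷ x) zero    | false = trans (position-absent y (values x) y∈?) (sym (position-∷ʳ y (values x) y∈?))
    lookup-rgs (y ∷ x) (suc a) | false = trans (lookup-rgs x a) (sym (position-++ (lookup x a) (values x) [ y ] (∈ᵇ-values x a)))

    eqF≡rgs-≡ᵇ : ∀ {N} (x : Vec (Fin k) N) a b → eqF (lookup x a) (lookup x b) ≡ (lookup (rgs x) a ≡ᵇ lookup (rgs x) b)
    eqF≡rgs-≡ᵇ x a b = T-injective (mk⇔ same⇒ ≡ᵇ⇒same)
      where
      same⇒ : T (eqF (lookup x a) (lookup x b)) → T (lookup (rgs x) a ≡ᵇ lookup (rgs x) b)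
      same⇒ t = ≡⇒≡ᵇ _ _ (trans (lookup-rgs x a) (trans (cong (λ c → position c (values x)) (to T-eqF t)) (sym (lookup-rgs x b))))
      ≡ᵇ⇒same : T (lookup (rgs x) a ≡ᵇ lookup (rgs x) b) → T (eqF (lookup x a) (lookup x b))
      ≡ᵇ⇒same t = from T-eqF (position-injective _ _ (values x) (∈ᵇ-values x a) (∈ᵇ-values x b)
                   (trans (sym (lookup-rgs x a)) (trans (≡ᵇ⇒≡ _ _ t) (lookup-rgs x b))))

  -- The restricted growth strings of length N, read from the right, each paired with its number b of
  -- distinct letters; a new letter is always b.
  extensions : ∀ {N} → ℕ × Vec ℕ N → List (ℕ × Vec ℕ (suc N))
  extensions (b , π) = map (λ l → b , l ∷ π) (upTo b) ++ [ suc b , b ∷ π ]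

  growthStrings : ∀ N → List (ℕ × Vec ℕ N)
  growthStrings zero    = [ 0 , [] ]
  growthStrings (suc N) = concatMap extensions (growthStrings N)

  ∑-rgs : ∀ N k (W : ℕ → Vec ℕ N → ℕ) →
          ∑[ x ∈ vecsOf N (allFin k) ] W (length (values x)) (rgs x) ≡ ∑ (growthStrings N) (λ (b , π) → (k P′ b) * W b π)
  ∑-rgs zero    k W = sym (+-identityʳ (W 0 [] + 0))
  ∑-rgs (suc N) k W = begin
    ∑[ x ∈ vecsOf (suc N) (allFin k) ] W (length (values x)) (rgs x)
      ≡⟨ ∑-vecsOf-suc N (allFin k) _ ⟩
    ∑[ y ∈ allFin k ] ∑[ x ∈ vecsOf N (allFin k) ] W (length (values (y ∷ x))) (rgs (y ∷ x))
      ≡⟨ ∑-comm (allFin k) (vecsOf N (allFin k)) _ ⟩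
    ∑[ x ∈ vecsOf N (allFin k) ] ∑[ y ∈ allFin k ] W (length (values (y ∷ x))) (rgs (y ∷ x))
      ≡⟨ ∑-cong (vecsOf N (allFin k)) ∑-first-entry ⟩
    ∑[ x ∈ vecsOf N (allFin k) ] W′ (length (values x)) (rgs x)
      ≡⟨ ∑-rgs N k W′ ⟩
    ∑ (growthStrings N) (λ (b , π) → (k P′ b) * W′ b π)
      ≡⟨ ∑-cong (growthStrings N) ∑-extensions ⟨
    ∑[ bπ ∈ growthStrings N ] ∑ (extensions bπ) (λ (b , π) → (k P′ b) * W b π)
      ≡⟨ ∑-concatMap extensions (growthStrings N) _ ⟨
    ∑ (growthStrings (suc N)) (λ (b , π) → (k P′ b) * W b π) ∎
    where
    open ≡-Reasoning
    W′ : ℕ → Vec ℕ N → ℕ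
    W′ b π = (∑[ l ∈ upTo b ] W b (l ∷ π)) + (k ∸ b) * W (suc b) (b ∷ π)

    ∑-first-entry : ∀ x → ∑[ y ∈ allFin k ] W (length (values (y ∷ x))) (rgs (y ∷ x)) ≡ W′ (length (values x)) (rgs x)
    ∑-first-entry x = trans (∑-cong (allFin k) old-or-new)
                            (∑-by-membership (values x) (values-distinct x) (λ l → W b (l ∷ rgs x)) (W (suc b) (b ∷ rgs x)))
      where
      b = length (values x)
      old-or-new : ∀ y → W (length (values (y ∷ x))) (rgs (y ∷ x))
                         ≡ (if y ∈ᵇ values x then W b (position y (values x) ∷ rgs x) else W (suc b) (b ∷ rgs x))
      old-or-new y with y ∈ᵇ values x in y∈?
      ... | true  = refl
      ... | false = cong₂ (λ b′ l → W b′ (l ∷ rgs x))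
                          (trans (length-++ (values x)) (+-comm b 1))
                          (position-absent y (values x) y∈?)

    ∑-extensions : ∀ ((b , π) : ℕ × Vec ℕ N) → ∑ (extensions (b , π)) (λ (b′ , π′) → (k P′ b′) * W b′ π′) ≡ (k P′ b) * W′ b π
    ∑-extensions (b , π) = begin
      ∑ (extensions (b , π)) (λ (b′ , π′) → (k P′ b′) * W b′ π′)
        ≡⟨ ∑-++ (map (λ l → b , l ∷ π) (upTo b)) _ _ ⟩
      ∑ (map (λ l → b , l ∷ π) (upTo b)) (λ (b′ , π′) → (k P′ b′) * W b′ π′) + ((k P′ suc b) * W (suc b) (b ∷ π) + 0)
        ≡⟨ cong₂ _+_ (∑-map (λ l → b , l ∷ π) (upTo b) _) (+-identityʳ _) ⟩
      (∑[ l ∈ upTo b ] (k P′ b) * W b (l ∷ π)) + (k P′ suc b) * W (suc b) (b ∷ π)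
        ≡⟨ cong₂ _+_ (*-∑ (k P′ b) (upTo b) _) fresh-term ⟨
      (k P′ b) * (∑[ l ∈ upTo b ] W b (l ∷ π)) + (k P′ b) * ((k ∸ b) * W (suc b) (b ∷ π))
        ≡⟨ *-distribˡ-+ (k P′ b) _ _ ⟨
      (k P′ b) * W′ b π ∎
      where
      fresh-term : (k P′ b) * ((k ∸ b) * W (suc b) (b ∷ π)) ≡ (k P′ suc b) * W (suc b) (b ∷ π)
      fresh-term = trans (sym (*-assoc (k P′ b) (k ∸ b) _)) (cong (_* W (suc b) (b ∷ π)) (*-comm (k P′ b) (k ∸ b)))

  T-eqF∨not : ∀ {k c} (i j : Fin k) (a b : Fin c) → T (eqF i j ∨ not (eqF a b)) ⇔ (a ≡ b → i ≡ j)
  T-eqF∨not i j a b with i ≟ j | a ≟ b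
  ... | yes i≡j | _        = mk⇔ (λ _ _ → i≡j) (λ _ → tt)
  ... | no _    | no a≢b   = mk⇔ (λ _ a≡b → ⊥-elim (a≢b a≡b)) (λ _ → tt)
  ... | no i≢j  | yes a≡b  = mk⇔ (λ ()) (λ i≡j → i≢j (i≡j a≡b))

  injectiveᵇ : ∀ {c h} → Vec (Fin c) h → Bool
  injectiveᵇ f = allF λ i → allF λ j → eqF i j ∨ not (eqF (lookup f i) (lookup f j))

  T-injectiveᵇ : ∀ {c h} (f : Vec (Fin c) h) → T (injectiveᵇ f) ⇔ Injective _≡_ _≡_ (lookup f)
  T-injectiveᵇ f = mk⇔ (λ t {i} {j} → to (T-eqF∨not i j _ _) (to T-allF (to T-allF t i) j))
                       (λ inj → from T-allF λ i → from T-allF λ j → from (T-eqF∨not i j _ _) inj)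

  T-∈ᵇ-toList : ∀ {k b} (y : Fin k) (x : Vec (Fin k) b) → T (y ∈ᵇ Vec.toList x) ⇔ ∃ λ j → y ≡ lookup x j
  T-∈ᵇ-toList y []      = mk⇔ (λ ()) (λ ())
  T-∈ᵇ-toList y (z ∷ x) = mk⇔
    (λ t → case-∨ (to T-∨ t))
    (λ { (zero , y≡z) → from T-∨ (inj₁ (from T-eqF y≡z)) ; (suc j , y≡xj) → from T-∨ (inj₂ (from (T-∈ᵇ-toList y x) (j , y≡xj))) })
    where
    case-∨ : T (eqF y z) ⊎ T (y ∈ᵇ Vec.toList x) → ∃ λ j → y ≡ lookup (z ∷ x) j
    case-∨ (inj₁ y≡z) = zero , to T-eqF y≡z
    case-∨ (inj₂ y∈x) = let j , y≡xj = to (T-∈ᵇ-toList y x) y∈x in suc j , y≡xj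

  module _ {k : ℕ} where

    injective-∷ : ∀ {b} (y : Fin k) (x : Vec (Fin k) b) →
                  Injective _≡_ _≡_ (lookup (y ∷ x)) ⇔ (T (not (y ∈ᵇ Vec.toList x)) × Injective _≡_ _≡_ (lookup x))
    injective-∷ y x = mk⇔ split (λ (y∉x , inj) → join y∉x inj)
      where
      tail-injective : Injective _≡_ _≡_ (lookup (y ∷ x)) → Injective _≡_ _≡_ (lookup x)
      tail-injective inj e = suc-injective (inj e)
      fresh : Injective _≡_ _≡_ (lookup (y ∷ x)) → T (not (y ∈ᵇ Vec.toList x))
      fresh inj with y ∈ᵇ Vec.toList x in y∈?
      ... | false = tt
      ... | true  = let j , y≡xj = to (T-∈ᵇ-toList y x) (from T-≡ y∈?) in zero≢suc (inj y≡xj)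
        where zero≢suc : ∀ {b} {j : Fin b} → zero ≢ suc j
              zero≢suc ()
      not-T : ∀ {a} → T (not a) → T a → ⊥
      not-T {true} () _
      join : T (not (y ∈ᵇ Vec.toList x)) → Injective _≡_ _≡_ (lookup x) → Injective _≡_ _≡_ (lookup (y ∷ x))
      join y∉x inj {zero}  {zero}  _    = refl
      join y∉x inj {zero}  {suc j} y≡xj = ⊥-elim (not-T y∉x (from (T-∈ᵇ-toList y x) (j , y≡xj)))
      join y∉x inj {suc i} {zero}  xi≡y = ⊥-elim (not-T y∉x (from (T-∈ᵇ-toList y x) (i , sym xi≡y)))
      join y∉x inj {suc i} {suc j} e    = cong suc (inj e)
      split : Injective _≡_ _≡_ (lookup (y ∷ x)) → T (not (y ∈ᵇ Vec.toList x)) × Injective _≡_ _≡_ (lookup x)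
      split inj = fresh inj , tail-injective inj

    Distinct-toList : ∀ {b} (x : Vec (Fin k) b) → T (injectiveᵇ x) → Distinct (Vec.toList x)
    Distinct-toList []      _ = tt
    Distinct-toList (y ∷ x) t =
      let y∉x , inj = to (injective-∷ y x) (to (T-injectiveᵇ (y ∷ x)) t)
      in to T-not-≡ y∉x , Distinct-toList x (from (T-injectiveᵇ x) inj)

  K : ℕ → Graph
  K b = record
    { n     = b
    ; adj   = λ i j → not (eqF i j)
    ; sym   = λ i j → cong not (eqF-sym i j)
    ; irrfl = λ i → cong not (eqF-refl i)
    }

  chromPoly-K : ∀ b k → chromPoly (K b) k ≡ k P′ b
  chromPoly-K b k = begin
    chromPoly (K b) k
      ≡⟨ count≡∑ (isProper (K b)) (allVecs b k) ⟩
    ∑[ x ∈ allVecs b k ] 𝟙 (isProper (K b) x)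
      ≡⟨ cong (λ xs → ∑[ x ∈ xs ] 𝟙 (isProper (K b) x)) (allVecs≡vecsOf b k) ⟩
    ∑[ x ∈ vecsOf b (allFin k) ] 𝟙 (isProper (K b) x)
      ≡⟨ ∑-cong (vecsOf b (allFin k)) (λ x → cong 𝟙 (proper≡injective x)) ⟩
    ∑[ x ∈ vecsOf b (allFin k) ] 𝟙 (injectiveᵇ x)
      ≡⟨ count-injective b ⟩
    k P′ b ∎
    where
    open ≡-Reasoning
    proper≡injective : ∀ {b} (x : Vec (Fin k) b) → isProper (K b) x ≡ injectiveᵇ x
    proper≡injective x = allF-cong λ i → allF-cong λ j → cong (_∨ not (eqF (lookup x i) (lookup x j))) (not-involutive (eqF i j))

    𝟙-injective-∷ : ∀ {b} y (x : Vec (Fin k) b) → 𝟙 (injectiveᵇ (y ∷ x)) ≡ 𝟙 (not (y ∈ᵇ Vec.toList x)) * 𝟙 (injectiveᵇ x)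
    𝟙-injective-∷ y x = trans (cong 𝟙 (T-injective (mk⇔
      (λ t → from T-∧ (map₂ (from (T-injectiveᵇ x)) (to (injective-∷ y x) (to (T-injectiveᵇ (y ∷ x)) t))))
      (λ t → from (T-injectiveᵇ (y ∷ x)) (from (injective-∷ y x) (map₂ (to (T-injectiveᵇ x)) (to T-∧ t)))))))
      (𝟙-∧ _ (injectiveᵇ x))

    fresh-colours : ∀ {b} (x : Vec (Fin k) b) → ∑[ y ∈ allFin k ] 𝟙 (not (y ∈ᵇ Vec.toList x)) * 𝟙 (injectiveᵇ x) ≡ (k ∸ b) * 𝟙 (injectiveᵇ x)
    fresh-colours {b} x with injectiveᵇ x in inj
    ... | false = trans (∑-cong (allFin k) (λ y → *-zeroʳ (𝟙 (not (y ∈ᵇ Vec.toList x))))) (trans (∑-zero (allFin k)) (sym (*-zeroʳ (k ∸ b))))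
    ... | true  = begin
      ∑[ y ∈ allFin k ] 𝟙 (not (y ∈ᵇ Vec.toList x)) * 1  ≡⟨ ∑-cong (allFin k) (λ y → *-identityʳ _) ⟩
      ∑[ y ∈ allFin k ] 𝟙 (not (y ∈ᵇ Vec.toList x))      ≡⟨ count-absent (Vec.toList x) (Distinct-toList x (from T-≡ inj)) ⟩
      k ∸ length (Vec.toList x)                           ≡⟨ cong (k ∸_) (length-toList x) ⟩
      k ∸ b                                               ≡⟨ *-identityʳ (k ∸ b) ⟨
      (k ∸ b) * 1                                         ∎

    count-injective : ∀ b → ∑[ x ∈ vecsOf b (allFin k) ] 𝟙 (injectiveᵇ x) ≡ k P′ b
    count-injective zero    = refl
    count-injective (suc b) = begin
      ∑[ x ∈ vecsOf (suc b) (allFin k) ] 𝟙 (injectiveᵇ x)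
        ≡⟨ ∑-vecsOf-suc b (allFin k) _ ⟩
      ∑[ y ∈ allFin k ] ∑[ x ∈ vecsOf b (allFin k) ] 𝟙 (injectiveᵇ (y ∷ x))
        ≡⟨ ∑-cong (allFin k) (λ y → ∑-cong (vecsOf b (allFin k)) (𝟙-injective-∷ y)) ⟩
      ∑[ y ∈ allFin k ] ∑[ x ∈ vecsOf b (allFin k) ] 𝟙 (not (y ∈ᵇ Vec.toList x)) * 𝟙 (injectiveᵇ x)
        ≡⟨ ∑-comm (allFin k) (vecsOf b (allFin k)) _ ⟩
      ∑[ x ∈ vecsOf b (allFin k) ] ∑[ y ∈ allFin k ] 𝟙 (not (y ∈ᵇ Vec.toList x)) * 𝟙 (injectiveᵇ x)
        ≡⟨ ∑-cong (vecsOf b (allFin k)) fresh-colours ⟩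
      ∑[ x ∈ vecsOf b (allFin k) ] (k ∸ b) * 𝟙 (injectiveᵇ x)
        ≡⟨ *-∑ (k ∸ b) (vecsOf b (allFin k)) _ ⟨
      (k ∸ b) * (∑[ x ∈ vecsOf b (allFin k) ] 𝟙 (injectiveᵇ x))
        ≡⟨ cong ((k ∸ b) *_) (count-injective b) ⟩
      k P′ suc b ∎

  module Copies (H : Graph) {c : ℕ} (E : Fin c → Fin c → Bool) where

    image : Vec (Fin c) (n H) → Vec Bool c
    image f = Vec.tabulate λ u → anyF λ i → eqF (lookup f i) u

    preservesᵇ : Vec (Fin c) (n H) → Bool
    preservesᵇ f = allF λ i → allF λ j → ⌊ adj H i j ≟ᵇ E (lookup f i) (lookup f j) ⌋

    -- For E = colAdj G k, hasCopy is inducesCopy H G k by definition.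
    isCopy : Vec Bool c → Vec (Fin c) (n H) → Bool
    isCopy U f = injectiveᵇ f ∧ (allF (λ u → ⌊ lookup U u ≟ᵇ (anyF λ i → eqF (lookup f i) u) ⌋) ∧ preservesᵇ f)

    embeddingᵇ : Vec (Fin c) (n H) → Bool
    embeddingᵇ f = injectiveᵇ f ∧ preservesᵇ f

    hasCopy : Vec Bool c → Bool
    hasCopy U = any (isCopy U) (allVecs (n H) c)

    record IsCopy (U : Vec Bool c) (f : Vec (Fin c) (n H)) : Set where
      field
        injective : Injective _≡_ _≡_ (lookup f)
        image≡    : ∀ u → lookup U u ≡ anyF (λ i → eqF (lookup f i) u)
        preserves : ∀ i j → adj H i j ≡ E (lookup f i) (lookup f j)

    T-isCopy : ∀ U f → T (isCopy U f) ⇔ IsCopy U f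
    T-isCopy U f = mk⇔ to-IsCopy from-IsCopy
      where
      to-IsCopy : T (isCopy U f) → IsCopy U f
      to-IsCopy t = let inj , rest = to T-∧ t ; img , pres = to T-∧ rest in record
        { injective = to (T-injectiveᵇ f) inj
        ; image≡    = to T-∀≡ img
        ; preserves = λ i → to T-∀≡ (to T-allF pres i)
        }
      from-IsCopy : IsCopy U f → T (isCopy U f)
      from-IsCopy cp = from T-∧ (from (T-injectiveᵇ f) (IsCopy.injective cp) , from T-∧
        ( from T-∀≡ (IsCopy.image≡ cp)
        , from T-allF (λ i → from T-∀≡ (IsCopy.preserves cp i))))

    isCopy≡embedding∧image : ∀ U f → isCopy U f ≡ embeddingᵇ f ∧ ⌊ ≡-dec _≟ᵇ_ U (image f) ⌋
    isCopy≡embedding∧image U f = trans (cong (λ b → injectiveᵇ f ∧ (b ∧ preservesᵇ f)) image-test) (rearrange (injectiveᵇ f) _ _)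
      where
      image-test : allF (λ u → ⌊ lookup U u ≟ᵇ (anyF λ i → eqF (lookup f i) u) ⌋) ≡ ⌊ ≡-dec _≟ᵇ_ U (image f) ⌋
      image-test = T-injective (mk⇔
        (λ t → from (T-⌊⌋ _) (lookup-ext λ u → trans (to T-∀≡ t u) (sym (lookup∘tabulate _ u))))
        (λ t → from T-∀≡ λ u → trans (cong (λ V → lookup V u) (to (T-⌊⌋ _) t)) (lookup∘tabulate _ u)))
      rearrange : ∀ a b c → a ∧ (b ∧ c) ≡ (a ∧ c) ∧ b
      rearrange true  b c = ∧-comm b c
      rearrange false b c = refl

  -- An automorphism of H is a copy of H in H whose image is all of V(H).
  automorphisms : Graph → ℕ
  automorphisms H = count (Copies.isCopy H (adj H) (Vec.replicate (n H) true)) (allVecs (n H) (n H))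

  module _ (H : Graph) {c : ℕ} (E : Fin c → Fin c → Bool) where

    open Copies H E
    private module Aut = Copies H (adj H)

    -- Precomposition with automorphisms is a bijection onto the copies of H with a given image.
    copies-with-image : ∀ {U f₀} → IsCopy U f₀ → ∑[ f ∈ allVecs (n H) c ] 𝟙 (isCopy U f) ≡ automorphisms H
    copies-with-image {U} {f₀} c₀ = sym (begin
      automorphisms H
        ≡⟨ count≡∑ _ (allVecs (n H) (n H)) ⟩
      ∑[ σ ∈ allVecs (n H) (n H) ] 𝟙 (Aut.isCopy full σ)
        ≡⟨ ∑-bijection (allVecs-enumerates (n H) (n H)) (allVecs-enumerates (n H) c)
                                                                            φ ψ φ-ok ψ-ok ⟩
      ∑[ f ∈ allVecs (n H) c ] 𝟙 (isCopy U f)                          ∎)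
      where
      open ≡-Reasoning
      module C₀ = IsCopy c₀
      full = Vec.replicate (n H) true

      preimage : Fin c → Fin (n H) → Fin (n H)
      preimage u fallback with any? (λ j → lookup f₀ j ≟ u)
      ... | yes (j , _) = j
      ... | no _        = fallback

      preimage-spec : ∀ {u} j fallback → lookup f₀ j ≡ u → lookup f₀ (preimage u fallback) ≡ u
      preimage-spec {u} j fallback f₀j≡u with any? (λ j → lookup f₀ j ≟ u)
      ... | yes (_ , e) = e
      ... | no ∄        = ⊥-elim (∄ (j , f₀j≡u))

      in-image : ∀ {f} → IsCopy U f → ∀ u → (∃ λ i → lookup f i ≡ u) → ∃ λ j → lookup f₀ j ≡ u
      in-image {f} cp u ∃i = to (T-image f₀ u) (subst T (trans (sym (IsCopy.image≡ cp u)) (C₀.image≡ u)) (from (T-image f u) ∃i))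

      φ : Vec (Fin (n H)) (n H) → Vec (Fin c) (n H)
      φ σ = Vec.map (lookup f₀) σ

      ψ : Vec (Fin c) (n H) → Vec (Fin (n H)) (n H)
      ψ f = Vec.tabulate λ i → preimage (lookup f i) i

      φ-ok : ∀ σ → T (Aut.isCopy full σ) → T (isCopy U (φ σ)) × ψ (φ σ) ≡ σ
      φ-ok σ t = from (T-isCopy U (φ σ)) copy , lookup-ext ψφ≗id
        where
        aut = to (Aut.T-isCopy full σ) t
        module A = Aut.IsCopy aut
        lookup-φ : ∀ i → lookup (φ σ) i ≡ lookup f₀ (lookup σ i)
        lookup-φ i = lookup-map i (lookup f₀) σ
        surjective : ∀ j → ∃ λ i → lookup σ i ≡ j
        surjective j = to (T-image σ j) (subst T (trans (sym (lookup-replicate j true)) (A.image≡ j)) tt)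
        same-image : ∀ u → (∃ λ j → lookup f₀ j ≡ u) ⇔ (∃ λ i → lookup (φ σ) i ≡ u)
        same-image u = mk⇔ (λ (j , e) → let i , σi≡j = surjective j in i , trans (lookup-φ i) (trans (cong (lookup f₀) σi≡j) e))
                           (λ (i , e) → lookup σ i , trans (sym (lookup-φ i)) e)
        copy : IsCopy U (φ σ)
        copy = record
          { injective = λ e → A.injective (C₀.injective (trans (sym (lookup-φ _)) (trans e (lookup-φ _))))
          ; image≡    = λ u → trans (C₀.image≡ u) (T-injective (mk⇔
                          (λ t → from (T-image (φ σ) u) (to (same-image u) (to (T-image f₀ u) t)))
                          (λ t → from (T-image f₀ u) (from (same-image u) (to (T-image (φ σ) u) t)))))
          ; preserves = λ i j → trans (A.preserves i j) (trans (C₀.preserves (lookup σ i) (lookup σ j))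
                                  (sym (cong₂ E (lookup-φ i) (lookup-φ j))))
          }
        ψφ≗id : ∀ i → lookup (ψ (φ σ)) i ≡ lookup σ i
        ψφ≗id i = trans (lookup∘tabulate _ i) (C₀.injective (trans (preimage-spec (lookup σ i) i (sym (lookup-φ i))) (lookup-φ i)))

      ψ-ok : ∀ f → T (isCopy U f) → T (Aut.isCopy full (ψ f)) × φ (ψ f) ≡ f
      ψ-ok f t = from (Aut.T-isCopy full (ψ f)) automorphism , lookup-ext (λ i → trans (lookup-map i (lookup f₀) (ψ f)) (back i))
        where
        cp = to (T-isCopy U f) t
        module F = IsCopy cp
        back : ∀ i → lookup f₀ (lookup (ψ f) i) ≡ lookup f i
        back i = let j , f₀j≡fi = in-image cp (lookup f i) (i , refl)
                 in trans (cong (lookup f₀) (lookup∘tabulate _ i)) (preimage-spec j i f₀j≡fi)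
        hits : ∀ j → ∃ λ i → lookup (ψ f) i ≡ j
        hits j = let i , fi≡f₀j = to (T-image f (lookup f₀ j)) (subst T (trans (sym (C₀.image≡ _)) (F.image≡ _))
                                     (from (T-image f₀ (lookup f₀ j)) (j , refl)))
                 in i , C₀.injective (trans (back i) fi≡f₀j)
        automorphism : Aut.IsCopy full (ψ f)
        automorphism = record
          { injective = λ e → F.injective (trans (sym (back _)) (trans (cong (lookup f₀) e) (back _)))
          ; image≡    = λ j → trans (lookup-replicate j true) (sym (to T-≡ (from (T-image (ψ f) j) (hits j))))
          ; preserves = λ i j → trans (F.preserves i j) (trans (sym (cong₂ E (back i) (back j)))
                                  (sym (C₀.preserves (lookup (ψ f) i) (lookup (ψ f) j))))
          }

    hasCopy-*-automorphisms : ∀ U → 𝟙 (hasCopy U) * automorphisms H ≡ ∑[ f ∈ allVecs (n H) c ] 𝟙 (isCopy U f)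
    hasCopy-*-automorphisms U with hasCopy U in has?
    ... | false = sym (∑-𝟙-any-false (isCopy U) (allVecs (n H) c) has?)
    ... | true  = let f₀ , t = satisfied (any⁻ (isCopy U) (allVecs (n H) c) (from T-≡ has?))
                  in trans (+-identityʳ _) (sym (copies-with-image (to (T-isCopy U f₀) t)))

    count-copies : count hasCopy (allSubsets c) * automorphisms H ≡ count embeddingᵇ (allVecs (n H) c)
    count-copies = begin
      count hasCopy (allSubsets c) * automorphisms H
        ≡⟨ cong (_* automorphisms H) (count≡∑ hasCopy (allSubsets c)) ⟩
      (∑[ U ∈ allSubsets c ] 𝟙 (hasCopy U)) * automorphisms H
        ≡⟨ *-comm (∑[ U ∈ allSubsets c ] 𝟙 (hasCopy U)) _ ⟩
      automorphisms H * (∑[ U ∈ allSubsets c ] 𝟙 (hasCopy U))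
        ≡⟨ *-∑ (automorphisms H) (allSubsets c) _ ⟩
      ∑[ U ∈ allSubsets c ] automorphisms H * 𝟙 (hasCopy U)
        ≡⟨ ∑-cong (allSubsets c) (λ U → trans (*-comm (automorphisms H) _) (hasCopy-*-automorphisms U)) ⟩
      ∑[ U ∈ allSubsets c ] ∑[ f ∈ allVecs (n H) c ] 𝟙 (isCopy U f)
        ≡⟨ ∑-comm (allSubsets c) (allVecs (n H) c) _ ⟩
      ∑[ f ∈ allVecs (n H) c ] ∑[ U ∈ allSubsets c ] 𝟙 (isCopy U f)
        ≡⟨ ∑-cong (allVecs (n H) c) (λ f → ∑-cong (allSubsets c) (λ U → split U f)) ⟩
      ∑[ f ∈ allVecs (n H) c ] ∑[ U ∈ allSubsets c ] 𝟙 ⌊ ≡-dec _≟ᵇ_ U (image f) ⌋ * 𝟙 (embeddingᵇ f)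
        ≡⟨ ∑-cong (allVecs (n H) c) (λ f → ∑-select (allSubsets-enumerates c) (image f) (λ _ → 𝟙 (embeddingᵇ f))) ⟩
      ∑[ f ∈ allVecs (n H) c ] 𝟙 (embeddingᵇ f)
        ≡⟨ count≡∑ embeddingᵇ (allVecs (n H) c) ⟨
      count embeddingᵇ (allVecs (n H) c) ∎
      where
      open ≡-Reasoning
      split : ∀ U f → 𝟙 (isCopy U f) ≡ 𝟙 ⌊ ≡-dec _≟ᵇ_ U (image f) ⌋ * 𝟙 (embeddingᵇ f)
      split U f = trans (cong 𝟙 (isCopy≡embedding∧image U f)) (trans (𝟙-∧ (embeddingᵇ f) _) (*-comm (𝟙 (embeddingᵇ f)) _))

  count-cong : ∀ {A : Set} {p q : A → Bool} xs → (∀ x → p x ≡ q x) → count p xs ≡ count q xs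
  count-cong {p = p} {q} xs p≗q = trans (count≡∑ p xs) (trans (∑-cong xs (cong 𝟙 ∘ p≗q)) (sym (count≡∑ q xs)))

  module _ (H G : Graph) where

    -- same i u j w records whether colouring i of a family of n H colourings of G gives u the
    -- colour that colouring j gives w.
    Coincidences : Set
    Coincidences = Fin (n H) → Fin (n G) → Fin (n H) → Fin (n G) → Bool

    coincidencesBy : {A : Set} → (A → A → Bool) → Vec A (n H * n G) → Coincidences
    coincidencesBy _==_ x i u j w = lookup x (combine i u) == lookup x (combine j w)

    coincidences : ∀ {k} → Vec (Vec (Fin k) (n G)) (n H) → Coincidences
    coincidences T i u j w = eqF (lookup (lookup T i) u) (lookup (lookup T j) w)

    allProperᵖ distinctᵖ adjacencyᵖ embeddingᵖ properEmbeddingᵖ : Coincidences → Bool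
    allProperᵖ same = allF λ i → allF λ u → allF λ w → not (adj G u w) ∨ not (same i u i w)
    distinctᵖ  same = allF λ i → allF λ j → eqF i j ∨ not (allF λ v → same i v j v)
    adjacencyᵖ same = allF λ i → allF λ j → ⌊ adj H i j ≟ᵇ ⌊ count (λ v → not (same i v j v)) (allFin (n G)) ℕ.≟ 1 ⌋ ⌋
    embeddingᵖ same = distinctᵖ same ∧ adjacencyᵖ same
    properEmbeddingᵖ same = allProperᵖ same ∧ embeddingᵖ same

    module _ {same same′ : Coincidences} (same≗ : ∀ i u j w → same i u j w ≡ same′ i u j w) where

      embeddingᵖ-cong : embeddingᵖ same ≡ embeddingᵖ same′
      embeddingᵖ-cong = cong₂ _∧_
        (allF-cong λ i → allF-cong λ j → cong (λ b → eqF i j ∨ not b) (allF-cong λ v → same≗ i v j v))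
        (allF-cong λ i → allF-cong λ j →
          cong (λ m → ⌊ adj H i j ≟ᵇ ⌊ m ℕ.≟ 1 ⌋ ⌋) (count-cong (allFin (n G)) λ v → cong not (same≗ i v j v)))

      properEmbeddingᵖ-cong : properEmbeddingᵖ same ≡ properEmbeddingᵖ same′
      properEmbeddingᵖ-cong = cong₂ _∧_
        (allF-cong λ i → allF-cong λ u → allF-cong λ w → cong (λ b → not (adj G u w) ∨ not b) (same≗ i u i w))
        embeddingᵖ-cong

    module _ (k : ℕ) where

      open Copies H (colAdj G k) using (embeddingᵇ)

      embeddingᵇ≡embeddingᵖ : ∀ f → embeddingᵇ f ≡ embeddingᵖ (coincidences (Vec.map (colour G k) f))
      embeddingᵇ≡embeddingᵖ f = trans
        (cong (_∧ adjacencyᵖ colours) (allF-cong λ i → allF-cong λ j → cong (λ b → eqF i j ∨ not b) (same-colouring (lookup f i) (lookup f j))))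
        (embeddingᵖ-cong {colours} λ i u j w → sym (cong₂ (λ c d → eqF (lookup c u) (lookup d w)) (lookup-map i (colour G k) f) (lookup-map j (colour G k) f)))
        where
        colours : Coincidences
        colours i u j w = eqF (lookup (colour G k (lookup f i)) u) (lookup (colour G k (lookup f j)) w)
        same-colouring : ∀ a b → eqF a b ≡ (allF λ v → eqF (lookup (colour G k a) v) (lookup (colour G k b) v))
        same-colouring a b = T-injective (mk⇔
          (λ t → from T-allF λ v → from T-eqF (cong (λ c → lookup (colour G k c) v) (to T-eqF t)))
          (λ t → from T-eqF (colour-injective G k a b (lookup-ext λ v → to T-eqF (to T-allF t v)))))

      count-embeddings : count embeddingᵇ (allVecs (n H) (numCol G k))
                         ≡ ∑ (growthStrings (n H * n G)) (λ (b , π) → (k P′ b) * 𝟙 (properEmbeddingᵖ (coincidencesBy _≡ᵇ_ π)))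
      count-embeddings = begin
        count embeddingᵇ (allVecs (n H) (numCol G k))
          ≡⟨ count≡∑ embeddingᵇ (allVecs (n H) (numCol G k)) ⟩
        ∑[ f ∈ allVecs (n H) (numCol G k) ] 𝟙 (embeddingᵇ f)
          ≡⟨ cong (λ fs → ∑[ f ∈ fs ] 𝟙 (embeddingᵇ f)) (allVecs≡vecsOf (n H) (numCol G k)) ⟩
        ∑[ f ∈ vecsOf (n H) (allFin (numCol G k)) ] 𝟙 (embeddingᵇ f)
          ≡⟨ ∑-cong (vecsOf (n H) (allFin (numCol G k))) (λ f → cong 𝟙 (embeddingᵇ≡embeddingᵖ f)) ⟩
        ∑[ f ∈ vecsOf (n H) (allFin (numCol G k)) ] 𝟙 (embeddingᵖ (coincidences (Vec.map (colour G k) f)))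
          ≡⟨ ∑-vecsOf-map (n H) (colour G k) (allFin (numCol G k)) (λ T → 𝟙 (embeddingᵖ (coincidences T))) ⟨
        ∑[ T ∈ vecsOf (n H) (map (colour G k) (allFin (numCol G k))) ] 𝟙 (embeddingᵖ (coincidences T))
          ≡⟨ cong (λ cs → ∑[ T ∈ vecsOf (n H) cs ] 𝟙 (embeddingᵖ (coincidences T))) colour-list ⟩
        ∑[ T ∈ vecsOf (n H) (properCols G k) ] 𝟙 (embeddingᵖ (coincidences T))
          ≡⟨ ∑-vecsOf-filter (n H) (isProper G) (allVecs (n G) k) (λ T → 𝟙 (embeddingᵖ (coincidences T))) ⟩
        ∑[ T ∈ vecsOf (n H) (allVecs (n G) k) ] 𝟙 (allF λ i → isProper G (lookup T i)) * 𝟙 (embeddingᵖ (coincidences T))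
          ≡⟨ ∑-cong (vecsOf (n H) (allVecs (n G) k)) (λ T → sym (𝟙-∧ (allProperᵖ (coincidences T)) _)) ⟩
        ∑[ T ∈ vecsOf (n H) (allVecs (n G) k) ] 𝟙 (properEmbeddingᵖ (coincidences T))
          ≡⟨ cong (λ cs → ∑[ T ∈ vecsOf (n H) cs ] 𝟙 (properEmbeddingᵖ (coincidences T))) (allVecs≡vecsOf (n G) k) ⟩
        ∑[ T ∈ vecsOf (n H) (vecsOf (n G) (allFin k)) ] 𝟙 (properEmbeddingᵖ (coincidences T))
          ≡⟨ ∑-cong (vecsOf (n H) (vecsOf (n G) (allFin k))) (λ T → cong 𝟙 (properEmbeddingᵖ-cong (concat-coincidences T))) ⟩
        ∑[ T ∈ vecsOf (n H) (vecsOf (n G) (allFin k)) ] 𝟙 (properEmbeddingᵖ (coincidencesBy eqF (Vec.concat T)))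
          ≡⟨ ∑-vecsOf-concat (n H) (n G) (allFin k) (λ x → 𝟙 (properEmbeddingᵖ (coincidencesBy eqF x))) ⟩
        ∑[ x ∈ vecsOf (n H * n G) (allFin k) ] 𝟙 (properEmbeddingᵖ (coincidencesBy eqF x))
          ≡⟨ ∑-cong (vecsOf (n H * n G) (allFin k)) (λ x → cong 𝟙 (properEmbeddingᵖ-cong (rgs-coincidences x))) ⟩
        ∑[ x ∈ vecsOf (n H * n G) (allFin k) ] 𝟙 (properEmbeddingᵖ (coincidencesBy _≡ᵇ_ (rgs x)))
          ≡⟨ ∑-rgs (n H * n G) k (λ _ π → 𝟙 (properEmbeddingᵖ (coincidencesBy _≡ᵇ_ π))) ⟩
        ∑ (growthStrings (n H * n G)) (λ (b , π) → (k P′ b) * 𝟙 (properEmbeddingᵖ (coincidencesBy _≡ᵇ_ π))) ∎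
        where
        open ≡-Reasoning
        colour-list : map (colour G k) (allFin (numCol G k)) ≡ properCols G k
        colour-list = trans (map-tabulate id (colour G k)) (tabulate-lookup (properCols G k))
        concat-coincidences : ∀ T i u j w → coincidences T i u j w ≡ coincidencesBy eqF (Vec.concat T) i u j w
        concat-coincidences T i u j w = sym (cong₂ eqF (lookup-concat T i u) (lookup-concat T j w))
        rgs-coincidences : ∀ x i u j w → coincidencesBy eqF x i u j w ≡ coincidencesBy _≡ᵇ_ (rgs x) i u j w
        rgs-coincidences x i u j w = eqF≡rgs-≡ᵇ x (combine i u) (combine j w)

  patternGraphs : Graph → Graph → List Graph
  patternGraphs H G = map (K ∘ proj₁)
    (filter (λ (b , π) → properEmbeddingᵖ H G (coincidencesBy H G _≡ᵇ_ π) ≟ᵇ true) (growthStrings (n H * n G)))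

  inducedCount-*-automorphisms : ∀ H G k → inducedCount H G k * automorphisms H ≡ ∑[ G′ ∈ patternGraphs H G ] chromPoly G′ k
  inducedCount-*-automorphisms H G k = begin
    inducedCount H G k * automorphisms H
      ≡⟨ count-copies H (colAdj G k) ⟩
    count (Copies.embeddingᵇ H (colAdj G k)) (allVecs (n H) (numCol G k))
      ≡⟨ count-embeddings H G k ⟩
    ∑ (growthStrings (n H * n G)) (λ (b , π) → (k P′ b) * 𝟙 (good π))
      ≡⟨ ∑-cong (growthStrings (n H * n G)) (λ (b , π) → trans (*-comm (k P′ b) _) (cong (𝟙 (good π) *_) (sym (chromPoly-K b k)))) ⟩
    ∑ (growthStrings (n H * n G)) (λ (b , π) → 𝟙 (good π) * chromPoly (K b) k)
      ≡⟨ ∑-filter (good ∘ proj₂) (growthStrings (n H * n G)) (λ (b , _) → chromPoly (K b) k) ⟨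
    ∑ (filter (λ (b , π) → good π ≟ᵇ true) (growthStrings (n H * n G))) (λ (b , _) → chromPoly (K b) k)
      ≡⟨ ∑-map (K ∘ proj₁) (filter (λ (b , π) → good π ≟ᵇ true) (growthStrings (n H * n G))) (λ G′ → chromPoly G′ k) ⟨
    ∑[ G′ ∈ patternGraphs H G ] chromPoly G′ k ∎
    where
    open ≡-Reasoning
    good : Vec ℕ (n H * n G) → Bool
    good π = properEmbeddingᵖ H G (coincidencesBy H G _≡ᵇ_ π)

  automorphisms-nonzero : ∀ H → 1 ≤ automorphisms H
  automorphisms-nonzero H = begin
    1                                                             ≡⟨ once (allVecs-enumerates (n H) (n H)) idH ⟨
    ∑[ σ ∈ allVecs (n H) (n H) ] 𝟙 ⌊ ≡-dec _≟_ σ idH ⌋           ≤⟨ ∑-mono-≤ (allVecs (n H) (n H)) only-identity ⟩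
    ∑[ σ ∈ allVecs (n H) (n H) ] 𝟙 (Aut.isCopy full σ)           ≡⟨ count≡∑ (Aut.isCopy full) (allVecs (n H) (n H)) ⟨
    automorphisms H                                               ∎
    where
    open ≤-Reasoning
    module Aut = Copies H (adj H)
    full = Vec.replicate (n H) true
    idH = Vec.allFin (n H)
    identity : Aut.IsCopy full idH
    identity = record
      { injective = λ {i} {j} e → trans (sym (lookup-allFin i)) (trans e (lookup-allFin j))
      ; image≡    = λ u → trans (lookup-replicate u true) (sym (to T-≡ (from (T-image idH u) (u , lookup-allFin u))))
      ; preserves = λ i j → sym (cong₂ (adj H) (lookup-allFin i) (lookup-allFin j))
      }
    only-identity : ∀ σ → 𝟙 ⌊ ≡-dec _≟_ σ idH ⌋ ≤ 𝟙 (Aut.isCopy full σ)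
    only-identity σ with ≡-dec _≟_ σ idH
    ... | yes refl = ≤-reflexive (sym (cong 𝟙 (to T-≡ (from (Aut.T-isCopy full idH) identity))))
    ... | no _     = z≤n

open Counting using (∑; patternGraphs; automorphisms; automorphisms-nonzero; inducedCount-*-automorphisms)

open import Data.Fin using (Fin)
open import Data.Integer as ℤ using (+_)
open import Data.Integer.Properties using (pos-+; pos-*; *-identityʳ)
open import Data.List using (List; []; _∷_; length; lookup)
open import Data.Nat as ℕ using (ℕ; _≤_)
open import Data.Nat.Coprimality using (1-coprimeTo) renaming (sym to coprime-sym)
open import Data.Product using (Σ; _,_)
open import Data.Rational as ℚ using (ℚ; mkℚ; _*_; 1/_)
open import Data.Rational.Properties using (normalize-coprime; *-identityˡ; *-inverseˡ; *-assoc; *-comm; *-zeroʳ; *-distribˡ-+)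
open import Relation.Binary.PropositionalEquality

ℕtoℚ≡mkℚ : ∀ m → ℕtoℚ m ≡ mkℚ (+ m) 0 (coprime-sym (1-coprimeTo m))
ℕtoℚ≡mkℚ m = normalize-coprime (coprime-sym (1-coprimeTo m))

ℕtoℚ-+ : ∀ a b → ℕtoℚ (a ℕ.+ b) ≡ ℕtoℚ a ℚ.+ ℕtoℚ b
ℕtoℚ-+ a b = trans (cong (ℚ._/ 1) sum-over-1) (sym (cong₂ ℚ._+_ (ℕtoℚ≡mkℚ a) (ℕtoℚ≡mkℚ b)))
  where
  sum-over-1 : + (a ℕ.+ b) ≡ (+ a ℤ.* + 1) ℤ.+ (+ b ℤ.* + 1)
  sum-over-1 = trans (pos-+ a b) (sym (cong₂ ℤ._+_ (*-identityʳ (+ a)) (*-identityʳ (+ b))))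

ℕtoℚ-* : ∀ a b → ℕtoℚ (a ℕ.* b) ≡ ℕtoℚ a * ℕtoℚ b
ℕtoℚ-* a b = trans (cong (ℚ._/ 1) (pos-* a b)) (sym (cong₂ _*_ (ℕtoℚ≡mkℚ a) (ℕtoℚ≡mkℚ b)))

sumℚ-* : ∀ c (Gs : List Graph) (F : Graph → ℕ) → sumℚ (λ i → c * ℕtoℚ (F (lookup Gs i))) ≡ c * ℕtoℚ (∑ Gs F)
sumℚ-* c []       F = sym (*-zeroʳ c)
sumℚ-* c (G ∷ Gs) F = begin
  c * ℕtoℚ (F G) ℚ.+ sumℚ (λ i → c * ℕtoℚ (F (lookup Gs i)))  ≡⟨ cong (c * ℕtoℚ (F G) ℚ.+_) (sumℚ-* c Gs F) ⟩
  c * ℕtoℚ (F G) ℚ.+ c * ℕtoℚ (∑ Gs F)                         ≡⟨ *-distribˡ-+ c _ _ ⟨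
  c * (ℕtoℚ (F G) ℚ.+ ℕtoℚ (∑ Gs F))                           ≡⟨ cong (c *_) (ℕtoℚ-+ (F G) (∑ Gs F)) ⟨
  c * ℕtoℚ (F G ℕ.+ ∑ Gs F)                                    ∎
  where open ≡-Reasoning

-- Built with mkℚ rather than ℕtoℚ b, so that its NonZero instance reduces to ℕ.NonZero b.
1/ℕ : (b : ℕ) → .{{ℕ.NonZero b}} → ℚ
1/ℕ b = 1/ mkℚ (+ b) 0 (coprime-sym (1-coprimeTo b))

ℕtoℚ-cancelʳ : ∀ a b {c} .{{_ : ℕ.NonZero b}} → a ℕ.* b ≡ c → ℕtoℚ a ≡ 1/ℕ b * ℕtoℚ c
ℕtoℚ-cancelʳ a b {c} a*b≡c = begin
  ℕtoℚ a                      ≡⟨ *-identityˡ (ℕtoℚ a) ⟨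
  ℚ.1ℚ * ℕtoℚ a               ≡⟨ cong (_* ℕtoℚ a) (*-inverseˡ q) ⟨
  (1/ q * q) * ℕtoℚ a         ≡⟨ *-assoc (1/ q) q (ℕtoℚ a) ⟩
  1/ q * (q * ℕtoℚ a)         ≡⟨ cong (1/ q *_) (*-comm q (ℕtoℚ a)) ⟩
  1/ q * (ℕtoℚ a * q)         ≡⟨ cong (λ r → 1/ q * (ℕtoℚ a * r)) (ℕtoℚ≡mkℚ b) ⟨
  1/ q * (ℕtoℚ a * ℕtoℚ b)    ≡⟨ cong (1/ q *_) (ℕtoℚ-* a b) ⟨
  1/ q * ℕtoℚ (a ℕ.* b)       ≡⟨ cong (λ m → 1/ q * ℕtoℚ m) a*b≡c ⟩
  1/ q * ℕtoℚ c               ∎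
  where
  open ≡-Reasoning
  q = mkℚ (+ b) 0 (coprime-sym (1-coprimeTo b))

theorem1p1 : (H : Graph) → Connected H →
    Σ (Graph → List Graph) λ alg →
      (G : Graph) →
        Σ (Fin (length (alg G)) → ℚ) λ a →
          (k : ℕ) → 1 ≤ k →
            ℕtoℚ (inducedCount H G k)
              ≡ sumℚ (λ i → a i * ℕtoℚ (chromPoly (lookup (alg G) i) k))
theorem1p1 H _ = patternGraphs H , λ G → (λ _ → 1/ℕ (automorphisms H)) , λ k _ →
  trans (ℕtoℚ-cancelʳ (inducedCount H G k) (automorphisms H) (inducedCount-*-automorphisms H G k))
        (sym (sumℚ-* (1/ℕ (automorphisms H)) (patternGraphs H G) (λ G′ → chromPoly G′ k)))
  where instance
  automorphisms≢0 : ℕ.NonZero (automorphisms H)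
  automorphisms≢0 = ℕ.>-nonZero (automorphisms-nonzero H)
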